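{- Let $\mathcal{F}$ be a family of tournaments, each on at least three vertices, let $G$ be a graph on $n$ vertices, and let $S\subseteq V(G)$ be a non-empty independent set; put $H=G-S$ and $s=|S|$. Then: (a) if $v\in S$ is a vertex for which $\|\vec{v}_{H,\mathcal{F}}\|_{s}$ is maximum among all vertices of $S$, then the graph $\widetilde{G}$ obtained from $G$ by deleting the vertices of $S\setminus\{v\}$ and adding $s-1$ new twins of $v$ satisfies $D(\widetilde{G},\mathcal{F})\geq D(G,\mathcal{F})$; (b) if $G$ is $\mathcal{F}$-extremal, then $\vec{u}_{H,\mathcal{F}}=\vec{w}_{H,\mathcal{F}}$ for any vertices $u,w\in S$.
   Context: All graphs are finite and simple; a tournament is an orientation of a complete graph. For a family $\mathcal{F}$ of oriented graphs, an orientation of $G$ is $\mathcal{F}$-free if it contains no subgraph isomorphic (as an oriented graph) to a member of $\mathcal{F}$; $\mathcal{D}(G,\mathcal{F})$ is the set of $\mathcal{F}$-free orientations of $G$ and $D(G,\mathcal{F})=|\mathcal{D}(G,\mathcal{F})|$. $D(n,\mathcal{F})=\max\{D(G,\mathcal{F}): |V(G)|=n\}$, and an $n$-vertex graph $G$ is $\mathcal{F}$-extremal if $D(G,\mathcal{F})=D(n,\mathcal{F})$. For an induced subgraph $H$ of $G$, a vertex $x\in V(G)\setminus V(H)$ and an $\mathcal{F}$-free orientation $\vec H$ of $H$, $c_{\mathcal{F}}(x,\vec H)$ is the number of ways to orient the edges between $x$ and $V(H)$ so that the resulting orientation of $G[V(H)\cup\{x\}]$ is $\mathcal{F}$-free.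 The vector $\vec{x}_{H,\mathcal{F}}$ is indexed by $\mathcal{D}(H,\mathcal{F})$ with coordinate $\vec{x}_{H,\mathcal{F}}(\vec H)=c_{\mathcal{F}}(x,\vec H)$. For a vector $\vec y$ indexed by a finite set $T$ and $p>0$, $\|\vec y\|_p=(\sum_{t\in T}|y(t)|^p)^{1/p}$. Two non-adjacent vertices are twins if they have the same neighborhood; a new twin of $v$ is a new vertex adjacent exactly to the neighbors of $v$ (the new twins being pairwise non-adjacent). -}

module Defs where

open import Data.Bool using (Bool; true; false; _∧_; _∨_; not; _xor_; if_then_else_)
open import Data.Nat using (ℕ; zero; suc; _^_; _≤_)
open import Data.Fin using (Fin; zero; suc) renaming (_≟_ to _≟F_)
open import Data.List using (List; []; _∷_; map; concatMap; length; filterᵇ; upTo; allFin)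
open import Data.Bool.ListAction using (all; any)
open import Data.Nat.ListAction using (sum)
open import Data.Product using (_×_)
open import Relation.Nullary.Decidable using (⌊_⌋)
open import Relation.Binary.PropositionalEquality using (_≡_; _≢_)

Rel₂ : ℕ → Set
Rel₂ n = Fin n → Fin n → Bool

VSet : ℕ → Set
VSet n = Fin n → Bool

record Graph (n : ℕ) : Set where
  field
    adj    : Rel₂ n
    sym    : ∀ i j → adj i j ≡ adj j i
    irrefl : ∀ i → adj i i ≡ false
open Graph public

_≟ᵇ_ : ∀ {n} → Fin n → Fin n → Bool
i ≟ᵇ j = ⌊ i ≟F j ⌋

allᶠ : ∀ {n} → (Fin n → Bool) → Bool
allᶠ {n} p = all p (allFin n)

anyᶠ : ∀ {n} → (Fin n → Bool) → Bool
anyᶠ {n} p = any p (allFin n)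

countᵇ : ∀ {A : Set} → (A → Bool) → List A → ℕ
countᵇ p xs = length (filterᵇ p xs)

consF : ∀ {B : Set} {k} → B → (Fin k → B) → Fin (suc k) → B
consF b f zero    = b
consF b f (suc i) = f i

-- list of all functions Fin k → B, given a list of all elements of B
-- (each function occurs exactly once up to pointwise equality)
funs : ∀ {B : Set} (k : ℕ) → List B → List (Fin k → B)
funs zero    bs = (λ ()) ∷ []
funs (suc k) bs = concatMap (λ b → map (consF b) (funs k bs)) bs

allRel : (n : ℕ) → List (Rel₂ n)
allRel n = funs n (funs n (true ∷ false ∷ []))

IsTournament : ∀ {k} → Rel₂ k → Set
IsTournament {k} T = (∀ i → T i i ≡ false) × (∀ i j → i ≢ j → (T i j xor T j i) ≡ true)

-- A family of oriented graphs, given by its (decidable) membership predicate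
-- on arc relations on Fin k, for each number k of vertices.
Family : Set
Family = (k : ℕ) → Rel₂ k → Bool

isOrientationOn : ∀ {n} → Graph n → VSet n → Rel₂ n → Bool
isOrientationOn G U R = allᶠ λ i → allᶠ λ j →
  if U i ∧ U j ∧ adj G i j then R i j xor R j i else not (R i j)

embedsᵇ : ∀ {k n} → Rel₂ k → Rel₂ n → (Fin k → Fin n) → Bool
embedsᵇ T R φ =
  (allᶠ λ i → allᶠ λ j → not (φ i ≟ᵇ φ j) ∨ (i ≟ᵇ j)) ∧
  (allᶠ λ i → allᶠ λ j → not (T i j) ∨ R (φ i) (φ j))

-- R contains a subgraph isomorphic to a member of F (members with more than
-- n vertices cannot embed injectively into Fin n, so k ≤ n suffices)
containsᵇ : ∀ {n} → Family → Rel₂ n → Bool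
containsᵇ {n} F R =
  any (λ k → any (λ T → F k T ∧ any (embedsᵇ T R) (funs k (allFin n))) (allRel k))
      (upTo (suc n))

freeᵇ : ∀ {n} → Family → Rel₂ n → Bool
freeᵇ F R = not (containsᵇ F R)

DList : ∀ {n} → Family → Graph n → VSet n → List (Rel₂ n)
DList {n} F G U = filterᵇ (λ R → isOrientationOn G U R ∧ freeᵇ F R) (allRel n)

Dnum : ∀ {n} → Family → Graph n → ℕ
Dnum F G = length (DList F G (λ _ → true))

Extremal : ∀ {n} → Family → Graph n → Set
Extremal {n} F G = (G' : Graph n) → Dnum F G' ≤ Dnum F G

addV : ∀ {n} → VSet n → Fin n → VSet n
addV U x i = U i ∨ (i ≟ᵇ x)

agreeOn : ∀ {n} → VSet n → Rel₂ n → Rel₂ n → Bool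
agreeOn U R Ho = allᶠ λ i → allᶠ λ j → not (U i ∧ U j) ∨ not (R i j xor Ho i j)

cF : ∀ {n} → Family → Graph n → VSet n → Fin n → Rel₂ n → ℕ
cF {n} F G U x Ho =
  countᵇ (λ R → isOrientationOn G (addV U x) R ∧ agreeOn U R Ho ∧ freeᵇ F R) (allRel n)

-- ‖x_{H,F}‖_p ^ p  (the p-th power of the p-norm)
normPow : ∀ {n} → Family → Graph n → VSet n → Fin n → ℕ → ℕ
normPow F G U x p = sum (map (λ Ho → cF F G U x Ho ^ p) (DList F G U))

Independent : ∀ {n} → Graph n → VSet n → Set
Independent G S = ∀ i j → S i ≡ true → S j ≡ true → adj G i j ≡ false

compl : ∀ {n} → VSet n → VSet n
compl S i = not (S i)

size : ∀ {n} → VSet n → ℕ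
size {n} S = countᵇ S (allFin n)

-- Realised on the same
-- vertex set Fin n: every vertex of S ∖ {v} is replaced by a twin of v
-- (vertex i of S gets the adjacencies of v).  Up to relabelling this is G̃.
retarget : ∀ {n} → VSet n → Fin n → Fin n → Fin n
retarget S v i = if S i then v else i

twinGraph : ∀ {n} → Graph n → VSet n → Fin n → Graph n
twinGraph G S v = record
  { adj    = λ i j → adj G (retarget S v i) (retarget S v j)
  ; sym    = λ i j → sym G (retarget S v i) (retarget S v j)
  ; irrefl = λ i → irrefl G (retarget S v i)
  }

-- Restricting orientations of G to H = G − S gives D(G) = Σ_H⃗ #(F-free extensions of H⃗ to G). As S is
-- independent and F consists of tournaments, no copy of a member of F meets two vertices of S, so
-- the extensions at the vertices of S combine freely: D(G) = Σ_H⃗ Π_{x∈S} c(x, H⃗). By AM-GM,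
-- s · Π_x c(x, H⃗) ≤ Σ_x c(x, H⃗)^s, and summing over H⃗ gives s · D(G) ≤ Σ_x ‖x‖ˢ ≤ s · ‖v‖ˢ for a
-- maximising v. In G̃ every vertex of S is a twin of v, so the same decomposition gives D(G̃) = ‖v‖ˢ.
-- If G is extremal, all these inequalities are equalities, and the equality case of AM-GM
-- forces c(u, H⃗) = c(w, H⃗).

module Submission where

open import Defs hiding (sym)
open import Data.Bool using (Bool; true; false; _∧_; _∨_; not; _xor_; if_then_else_)
open import Data.Bool.Properties using (∧-identityʳ; ∧-zeroʳ; ∨-identityʳ; ∨-zeroʳ)
open import Data.Bool.ListAction using (all; any)
open import Data.Empty using (⊥; ⊥-elim)
open import Data.Fin using (Fin; zero; suc) renaming (_≟_ to _≟F_)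
open import Data.Fin.Permutation.Components using (transpose)
open import Data.List using (List; []; _∷_; map; concatMap; length; filterᵇ; allFin; upTo; _++_; cartesianProduct)
open import Data.List.Extrema.Nat using (argmax; argmax-all; v≤f[argmax]⁺)
open import Data.List.Membership.Propositional using (_∈_)
open import Data.List.Membership.Propositional.Properties using (∈-map⁺; ∈-allFin; ∈-concatMap⁺)
open import Data.List.Relation.Unary.All as All using (All; []; _∷_)
open import Data.List.Relation.Unary.Any as Any using (here; there)
open import Data.List.Relation.Unary.Unique.Propositional using (Unique; []; _∷_)
open import Data.List.Relation.Unary.Unique.Propositional.Properties using (filter⁺; allFin⁺)
open import Data.Nat using (ℕ; zero; suc; _+_; _*_; _^_; _≤_; _<_; _∸_; z≤n)
open import Data.Nat.ListAction using (sum; product)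
open import Data.Nat.Properties
open import Data.Nat.Tactic.RingSolver using (solve-∀)
open import Algebra.Properties.CommutativeSemigroup +-commutativeSemigroup using () renaming (interchange to +-interchange)
open import Data.Product using (_×_; _,_; ∃; proj₁; proj₂)
open import Data.Sum using (_⊎_; inj₁; inj₂; [_,_]; [_,_]′)
open import Function using (_∘_)
open import Relation.Binary.Definitions using (tri<; tri≈; tri>)
open import Relation.Binary.PropositionalEquality hiding ([_])
open import Relation.Nullary using (¬_; Dec; yes; no)
open import Relation.Nullary.Decidable using (T?; dec-true; dec-false)

infixr 6 _&_
_&_ : ∀ {a b} → a ≡ true → b ≡ true → a ∧ b ≡ true
refl & refl = refl

∧-elimˡ : ∀ {a b} → a ∧ b ≡ true → a ≡ true
∧-elimˡ {true} _ = refl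

∧-elimʳ : ∀ {a b} → a ∧ b ≡ true → b ≡ true
∧-elimʳ {true} h = h

∨-elim : ∀ {a b} → a ∨ b ≡ true → a ≡ true ⊎ b ≡ true
∨-elim {true} _ = inj₁ refl
∨-elim {false} h = inj₂ h

xor-elim : ∀ {a b} → a xor b ≡ true → a ≡ true ⊎ b ≡ true
xor-elim {true} _ = inj₁ refl
xor-elim {false} h = inj₂ h

∧-not-elim : ∀ {a b} → a ∧ not b ≡ true → a ≡ true × b ≡ false
∧-not-elim {true} {false} _ = refl , refl

infixr 4 _⇒ᵇ_
_⇒ᵇ_ : Bool → Bool → Bool
a ⇒ᵇ b = not a ∨ b

_⇔ᵇ_ : Bool → Bool → Bool
a ⇔ᵇ b = not (a xor b)

⇒ᵇ-elim : ∀ {a b} → (a ⇒ᵇ b) ≡ true → a ≡ true → b ≡ true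
⇒ᵇ-elim {true} h refl = h

⇒ᵇ-intro : ∀ {a b} → (a ≡ true → b ≡ true) → (a ⇒ᵇ b) ≡ true
⇒ᵇ-intro {true} f = f refl
⇒ᵇ-intro {false} f = refl

⇒ᵇ-false : ∀ {a b} → (a ⇒ᵇ b) ≡ false → a ≡ true × b ≡ false
⇒ᵇ-false {true} {false} _ = refl , refl

⇔ᵇ⇒≡ : ∀ {a b} → (a ⇔ᵇ b) ≡ true → a ≡ b
⇔ᵇ⇒≡ {true} {true} _ = refl
⇔ᵇ⇒≡ {false} {false} _ = refl

≡⇒⇔ᵇ : ∀ {a b} → a ≡ b → (a ⇔ᵇ b) ≡ true
≡⇒⇔ᵇ {true} refl = refl
≡⇒⇔ᵇ {false} refl = refl

true-ext : ∀ {a b} → (a ≡ true → b ≡ true) → (b ≡ true → a ≡ true) → a ≡ b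
true-ext {true} {true} f g = refl
true-ext {false} {false} f g = refl
true-ext {true} {false} f g = sym (f refl)
true-ext {false} {true} f g = g refl

≢true⇒≡false : ∀ {a} → ¬ (a ≡ true) → a ≡ false
≢true⇒≡false {true} h = ⊥-elim (h refl)
≢true⇒≡false {false} h = refl

true≢false : ¬ (true ≡ false)
true≢false ()

not-elim : ∀ {a} → not a ≡ true → a ≡ false
not-elim {false} _ = refl

-- Truth tables: a Boolean identity in k variables is proved by  valid-sound k _ refl.

Bools : ℕ → Set
Bools zero = Bool
Bools (suc k) = Bool → Bools k

valid : ∀ k → Bools k → Bool
valid zero b = b
valid (suc k) f = valid k (f true) ∧ valid k (f false)

Holds : ∀ k → Bools k → Set
Holds zero b = b ≡ true
Holds (suc k) f = ∀ x → Holds k (f x)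

valid-sound : ∀ k f → valid k f ≡ true → Holds k f
valid-sound zero f h = h
valid-sound (suc k) f h true = valid-sound k (f true) (∧-elimˡ h)
valid-sound (suc k) f h false = valid-sound k (f false) (∧-elimʳ {valid k (f true)} h)

≟ᵇ⇒≡ : ∀ {n} {i j : Fin n} → (i ≟ᵇ j) ≡ true → i ≡ j
≟ᵇ⇒≡ {i = i} {j} h with i ≟F j
... | yes e = e
... | no _ = ⊥-elim (true≢false (sym h))

≟ᵇ-refl : ∀ {n} (i : Fin n) → (i ≟ᵇ i) ≡ true
≟ᵇ-refl i with i ≟F i
... | yes _ = refl
... | no ne = ⊥-elim (ne refl)

≢⇒≟ᵇ-false : ∀ {n} {i j : Fin n} → ¬ (i ≡ j) → (i ≟ᵇ j) ≡ false
≢⇒≟ᵇ-false {i = i} {j} ne with i ≟F j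
... | yes e = ⊥-elim (ne e)
... | no _ = refl

module _ {n : ℕ} (x v : Fin n) where

  transpose-x : transpose x v x ≡ v
  transpose-x rewrite dec-true (x ≟F x) refl = refl

  transpose-v : transpose x v v ≡ x
  transpose-v with v ≟F x
  ... | yes v≡x = v≡x
  ... | no _ rewrite dec-true (v ≟F v) refl = refl

  transpose-other : ∀ {k} → ¬ k ≡ x → ¬ k ≡ v → transpose x v k ≡ k
  transpose-other {k} k≢x k≢v rewrite dec-false (k ≟F x) k≢x | dec-false (k ≟F v) k≢v = refl

  transpose-involutive : ∀ k → transpose x v (transpose x v k) ≡ k
  transpose-involutive k = by-cases (k ≟F x) (k ≟F v)
    where
    by-cases : Dec (k ≡ x) → Dec (k ≡ v) → transpose x v (transpose x v k) ≡ k
    by-cases (yes refl) _ = trans (cong (transpose x v) transpose-x) transpose-v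
    by-cases (no _) (yes refl) = trans (cong (transpose x v) transpose-v) transpose-x
    by-cases (no k≢x) (no k≢v) = trans (cong (transpose x v) (transpose-other k≢x k≢v)) (transpose-other k≢x k≢v)

module _ {A : Set} where

  all-elim : ∀ (p : A → Bool) xs → all p xs ≡ true → ∀ {x} → x ∈ xs → p x ≡ true
  all-elim p (y ∷ ys) h (here refl) = ∧-elimˡ h
  all-elim p (y ∷ ys) h (there m) = all-elim p ys (∧-elimʳ {p y} h) m

  all-intro : ∀ (p : A → Bool) xs → (∀ {x} → x ∈ xs → p x ≡ true) → all p xs ≡ true
  all-intro p [] f = refl
  all-intro p (y ∷ ys) f = f (here refl) & all-intro p ys (λ m → f (there m))

  all-false : ∀ (p : A → Bool) xs → all p xs ≡ false → ∃ λ x → p x ≡ false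
  all-false p (y ∷ ys) h with p y in eq
  ... | false = y , eq
  ... | true = all-false p ys h

  any-elim : ∀ (p : A → Bool) xs → any p xs ≡ true → ∃ λ x → x ∈ xs × p x ≡ true
  any-elim p (y ∷ ys) h with p y in eq
  ... | true = y , here refl , eq
  ... | false with any-elim p ys h
  ...   | x , m , e = x , there m , e

  any-intro : ∀ (p : A → Bool) {xs x} → x ∈ xs → p x ≡ true → any p xs ≡ true
  any-intro p (here refl) e rewrite e = refl
  any-intro p {y ∷ _} (there m) e with p y
  ... | true = refl
  ... | false = any-intro p m e

  all-cong : ∀ {p q : A → Bool} xs → (∀ x → p x ≡ q x) → all p xs ≡ all q xs
  all-cong [] e = refl
  all-cong (y ∷ ys) e = cong₂ _∧_ (e y) (all-cong ys e)

  any-cong : ∀ {p q : A → Bool} xs → (∀ x → p x ≡ q x) → any p xs ≡ any q xs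
  any-cong [] e = refl
  any-cong (y ∷ ys) e = cong₂ _∨_ (e y) (any-cong ys e)

module _ {n : ℕ} where

  allᶠ-elim : (p : Fin n → Bool) → allᶠ p ≡ true → ∀ i → p i ≡ true
  allᶠ-elim p h i = all-elim p (allFin n) h (∈-allFin i)

  allᶠ-intro : (p : Fin n → Bool) → (∀ i → p i ≡ true) → allᶠ p ≡ true
  allᶠ-intro p f = all-intro p (allFin n) (λ {x} _ → f x)

  allᶠ-false : (p : Fin n → Bool) → allᶠ p ≡ false → ∃ λ i → p i ≡ false
  allᶠ-false p = all-false p (allFin n)

  allᶠ-cong : {p q : Fin n → Bool} → (∀ i → p i ≡ q i) → allᶠ p ≡ allᶠ q
  allᶠ-cong = all-cong (allFin n)

  allᶠ²-elim : (p : Fin n → Fin n → Bool) → (allᶠ λ i → allᶠ λ j → p i j) ≡ true → ∀ i j → p i j ≡ true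
  allᶠ²-elim p h i = allᶠ-elim (p i) (allᶠ-elim _ h i)

  allᶠ²-intro : (p : Fin n → Fin n → Bool) → (∀ i j → p i j ≡ true) → (allᶠ λ i → allᶠ λ j → p i j) ≡ true
  allᶠ²-intro p f = allᶠ-intro _ (λ i → allᶠ-intro (p i) (f i))

  allᶠ²-cong : {p q : Fin n → Fin n → Bool} → (∀ i j → p i j ≡ q i j)
             → (allᶠ λ i → allᶠ λ j → p i j) ≡ (allᶠ λ i → allᶠ λ j → q i j)
  allᶠ²-cong e = allᶠ-cong (λ i → allᶠ-cong (e i))

allᶠ²-relabel : ∀ {n} (σ : Fin n → Fin n) → (∀ i → σ (σ i) ≡ i) → (p : Fin n → Fin n → Bool)
              → (allᶠ λ i → allᶠ λ j → p i j) ≡ (allᶠ λ i → allᶠ λ j → p (σ i) (σ j))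
allᶠ²-relabel σ inv p = true-ext
  (λ h → allᶠ²-intro (λ i j → p (σ i) (σ j)) (λ i j → allᶠ²-elim p h (σ i) (σ j)))
  (λ h → allᶠ²-intro p (λ i j →
     subst₂ (λ a b → p a b ≡ true) (inv i) (inv j) (allᶠ²-elim (λ i j → p (σ i) (σ j)) h (σ i) (σ j))))

∑ : {A : Set} → List A → (A → ℕ) → ℕ
∑ xs f = sum (map f xs)

infix 5 ∑
syntax ∑ xs (λ x → e) = ∑[ x ∈ xs ] e

module _ {A : Set} where

  ∑-cong : ∀ {f g : A → ℕ} xs → (∀ {x} → x ∈ xs → f x ≡ g x) → ∑ xs f ≡ ∑ xs g
  ∑-cong [] e = refl
  ∑-cong (x ∷ xs) e = cong₂ _+_ (e (here refl)) (∑-cong xs (λ m → e (there m)))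

  ∑-mono-≤ : ∀ {f g : A → ℕ} xs → (∀ {x} → x ∈ xs → f x ≤ g x) → ∑ xs f ≤ ∑ xs g
  ∑-mono-≤ [] e = z≤n
  ∑-mono-≤ (x ∷ xs) e = +-mono-≤ (e (here refl)) (∑-mono-≤ xs (λ m → e (there m)))

  ∑-+ : ∀ (f g : A → ℕ) xs → ∑[ x ∈ xs ] (f x + g x) ≡ ∑ xs f + ∑ xs g
  ∑-+ f g [] = refl
  ∑-+ f g (x ∷ xs) = trans (cong (f x + g x +_) (∑-+ f g xs)) (+-interchange (f x) (g x) (∑ xs f) (∑ xs g))

  ∑-*ˡ : ∀ c (f : A → ℕ) xs → ∑[ x ∈ xs ] (c * f x) ≡ c * ∑ xs f
  ∑-*ˡ c f [] = sym (*-zeroʳ c)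
  ∑-*ˡ c f (x ∷ xs) = trans (cong (c * f x +_) (∑-*ˡ c f xs)) (sym (*-distribˡ-+ c (f x) _))

  ∑-*ʳ : ∀ c (f : A → ℕ) xs → ∑[ x ∈ xs ] (f x * c) ≡ (∑ xs f) * c
  ∑-*ʳ c f xs = trans (∑-cong xs (λ {x} _ → *-comm (f x) c)) (trans (∑-*ˡ c f xs) (*-comm c _))

  ∑-const : ∀ c (xs : List A) → ∑[ _ ∈ xs ] c ≡ length xs * c
  ∑-const c [] = refl
  ∑-const c (x ∷ xs) = cong (c +_) (∑-const c xs)

  ∑-++ : ∀ (f : A → ℕ) xs ys → ∑ (xs ++ ys) f ≡ ∑ xs f + ∑ ys f
  ∑-++ f [] ys = refl
  ∑-++ f (x ∷ xs) ys = trans (cong (f x +_) (∑-++ f xs ys)) (sym (+-assoc (f x) _ _))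

  ∑-tight : ∀ {f g : A → ℕ} xs → (∀ {x} → x ∈ xs → f x ≤ g x) → ∑ xs g ≤ ∑ xs f
          → ∀ {x} → x ∈ xs → f x ≡ g x
  ∑-tight {f} {g} (y ∷ ys) le ge (here refl) =
    ≤-antisym (le (here refl))
      (+-cancelʳ-≤ (∑ ys f) (g y) (f y) (≤-trans (+-monoʳ-≤ (g y) (∑-mono-≤ ys (λ m → le (there m)))) ge))
  ∑-tight {f} {g} (y ∷ ys) le ge (there m) =
    ∑-tight ys (λ m → le (there m))
      (+-cancelˡ-≤ (f y) (∑ ys g) (∑ ys f) (≤-trans (+-monoˡ-≤ (∑ ys g) (le (here refl))) ge)) m

  product-cong : ∀ {f g : A → ℕ} xs → (∀ {x} → x ∈ xs → f x ≡ g x) → product (map f xs) ≡ product (map g xs)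
  product-cong [] e = refl
  product-cong (x ∷ xs) e = cong₂ _*_ (e (here refl)) (product-cong xs (λ m → e (there m)))

  product-const : ∀ c (xs : List A) → product (map (λ _ → c) xs) ≡ c ^ length xs
  product-const c [] = refl
  product-const c (x ∷ xs) = cong (c *_) (product-const c xs)

∑-map : ∀ {A B : Set} (f : B → ℕ) (g : A → B) xs → ∑ (map g xs) f ≡ ∑[ x ∈ xs ] f (g x)
∑-map f g [] = refl
∑-map f g (x ∷ xs) = cong (f (g x) +_) (∑-map f g xs)

∑-concatMap : ∀ {A B : Set} (f : B → ℕ) (g : A → List B) xs → ∑ (concatMap g xs) f ≡ ∑[ x ∈ xs ] ∑ (g x) f
∑-concatMap f g [] = refl
∑-concatMap f g (x ∷ xs) = trans (∑-++ f (g x) (concatMap g xs)) (cong (∑ (g x) f +_) (∑-concatMap f g xs))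

∑-comm : ∀ {A B : Set} (f : A → B → ℕ) xs ys → ∑[ a ∈ xs ] ∑[ b ∈ ys ] f a b ≡ ∑[ b ∈ ys ] ∑[ a ∈ xs ] f a b
∑-comm f [] ys = sym (trans (∑-const 0 ys) (*-zeroʳ (length ys)))
∑-comm f (x ∷ xs) ys = trans (cong (∑ ys (f x) +_) (∑-comm f xs ys)) (sym (∑-+ (f x) _ ys))

∑-cartesianProduct : ∀ {A B : Set} (f : A × B → ℕ) xs ys → ∑ (cartesianProduct xs ys) f ≡ ∑[ a ∈ xs ] ∑[ b ∈ ys ] f (a , b)
∑-cartesianProduct f [] ys = refl
∑-cartesianProduct f (x ∷ xs) ys =
  trans (∑-++ f (map (x ,_) ys) _) (cong₂ _+_ (∑-map f (x ,_) ys) (∑-cartesianProduct f xs ys))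

indicator : Bool → ℕ
indicator true = 1
indicator false = 0

indicator-∧ : ∀ a b → indicator (a ∧ b) ≡ indicator a * indicator b
indicator-∧ true b = sym (+-identityʳ (indicator b))
indicator-∧ false b = refl

module _ {A : Set} where

  count-as-∑ : ∀ (p : A → Bool) xs → countᵇ p xs ≡ ∑[ x ∈ xs ] indicator (p x)
  count-as-∑ p [] = refl
  count-as-∑ p (x ∷ xs) with p x
  ... | true = cong suc (count-as-∑ p xs)
  ... | false = count-as-∑ p xs

  filterᵇ-cong : ∀ {p q : A → Bool} xs → (∀ x → p x ≡ q x) → filterᵇ p xs ≡ filterᵇ q xs
  filterᵇ-cong [] e = refl
  filterᵇ-cong {p} {q} (x ∷ xs) e with p x | q x | e x
  ... | true | .true | refl = cong (x ∷_) (filterᵇ-cong xs e)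
  ... | false | .false | refl = filterᵇ-cong xs e

  count-cong : ∀ {p q : A → Bool} xs → (∀ x → p x ≡ q x) → countᵇ p xs ≡ countᵇ q xs
  count-cong xs e = cong length (filterᵇ-cong xs e)

  count-∧ˡ : ∀ b (p : A → Bool) xs → countᵇ (λ x → b ∧ p x) xs ≡ indicator b * countᵇ p xs
  count-∧ˡ true p xs = sym (+-identityʳ _)
  count-∧ˡ false p [] = refl
  count-∧ˡ false p (_ ∷ xs) = count-∧ˡ false p xs

  count-filterᵇ : ∀ (p q : A → Bool) xs → countᵇ q (filterᵇ p xs) ≡ countᵇ (λ x → p x ∧ q x) xs
  count-filterᵇ p q [] = refl
  count-filterᵇ p q (x ∷ xs) with p x
  ... | false = count-filterᵇ p q xs
  ... | true with q x
  ...   | true = cong suc (count-filterᵇ p q xs)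
  ...   | false = count-filterᵇ p q xs

  count≡suc⇒∃ : ∀ (p : A → Bool) xs {k} → countᵇ p xs ≡ suc k → ∃ λ x → x ∈ xs × p x ≡ true
  count≡suc⇒∃ p (x ∷ xs) h with p x in eq
  ... | true = x , here refl , eq
  ... | false with count≡suc⇒∃ p xs h
  ...   | y , m , e = y , there m , e

  filterᵇ⁺ : ∀ (p : A → Bool) {xs x} → x ∈ xs → p x ≡ true → x ∈ filterᵇ p xs
  filterᵇ⁺ p (here refl) e rewrite e = here refl
  filterᵇ⁺ p {y ∷ _} (there m) e with p y
  ... | true = there (filterᵇ⁺ p m e)
  ... | false = filterᵇ⁺ p m e

  filterᵇ⁻ : ∀ (p : A → Bool) {xs x} → x ∈ filterᵇ p xs → x ∈ xs × p x ≡ true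
  filterᵇ⁻ p {y ∷ ys} m with p y in eq
  filterᵇ⁻ p {y ∷ ys} (here refl) | true = here refl , eq
  filterᵇ⁻ p {y ∷ ys} (there m) | true = let a , b = filterᵇ⁻ p m in there a , b
  filterᵇ⁻ p {y ∷ ys} m | false = let a , b = filterᵇ⁻ p m in there a , b

count-by-fibres : ∀ {A B : Set} (rel : A → B → Bool) (p : A → Bool) xs ys
  → (∀ a → countᵇ (rel a) ys ≡ indicator (p a))
  → countᵇ p xs ≡ ∑[ b ∈ ys ] countᵇ (λ a → rel a b) xs
count-by-fibres rel p xs ys rows = begin
  countᵇ p xs                                   ≡⟨ count-as-∑ p xs ⟩
  ∑[ a ∈ xs ] indicator (p a)                   ≡⟨ ∑-cong xs (λ {a} _ → trans (sym (rows a)) (count-as-∑ (rel a) ys)) ⟩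
  ∑[ a ∈ xs ] ∑[ b ∈ ys ] indicator (rel a b)   ≡⟨ ∑-comm (λ a b → indicator (rel a b)) xs ys ⟩
  ∑[ b ∈ ys ] ∑[ a ∈ xs ] indicator (rel a b)   ≡⟨ ∑-cong ys (λ {b} _ → sym (count-as-∑ (λ a → rel a b) xs)) ⟩
  ∑[ b ∈ ys ] countᵇ (λ a → rel a b) xs         ∎
  where open ≡-Reasoning

-- Bijective counting: xs and ys list every element exactly once up to ≈ᴬ and ≈ᴮ, and the last
-- hypothesis says that f and g are mutually inverse between the p-elements and the q-elements.
count-bijection : ∀ {A B : Set} (p : A → Bool) (q : B → Bool) xs ys (_≈ᴬ_ : A → A → Bool) (_≈ᴮ_ : B → B → Bool)
  → (∀ a → countᵇ (_≈ᴬ a) xs ≡ 1) → (∀ b → countᵇ (_≈ᴮ b) ys ≡ 1)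
  → (f : A → B) (g : B → A) → (∀ a b → (p a ∧ (b ≈ᴮ f a)) ≡ (q b ∧ (a ≈ᴬ g b)))
  → countᵇ p xs ≡ countᵇ q ys
count-bijection p q xs ys _≈ᴬ_ _≈ᴮ_ xs-once ys-once f g graph = begin
  countᵇ p xs                                      ≡⟨ count-by-fibres (λ a b → p a ∧ (b ≈ᴮ f a)) p xs ys row ⟩
  ∑[ b ∈ ys ] countᵇ (λ a → p a ∧ (b ≈ᴮ f a)) xs   ≡⟨ ∑-cong ys (λ {b} _ → column b) ⟩
  ∑[ b ∈ ys ] indicator (q b)                      ≡⟨ sym (count-as-∑ q ys) ⟩
  countᵇ q ys                                      ∎
  where
  open ≡-Reasoning
  row : ∀ a → countᵇ (λ b → p a ∧ (b ≈ᴮ f a)) ys ≡ indicator (p a)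
  row a = trans (count-∧ˡ (p a) (_≈ᴮ f a) ys) (trans (cong (indicator (p a) *_) (ys-once (f a))) (*-identityʳ _))
  column : ∀ b → countᵇ (λ a → p a ∧ (b ≈ᴮ f a)) xs ≡ indicator (q b)
  column b = trans (count-cong xs (λ a → graph a b))
               (trans (count-∧ˡ (q b) (_≈ᴬ g b) xs) (trans (cong (indicator (q b) *_) (xs-once (g b))) (*-identityʳ _)))

count-cartesianProduct : ∀ {A B : Set} (p : A → Bool) (q : B → Bool) xs ys
  → countᵇ (λ ab → p (proj₁ ab) ∧ q (proj₂ ab)) (cartesianProduct xs ys) ≡ countᵇ p xs * countᵇ q ys
count-cartesianProduct p q xs ys = begin
  countᵇ (λ ab → p (proj₁ ab) ∧ q (proj₂ ab)) (cartesianProduct xs ys)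
    ≡⟨ count-as-∑ _ (cartesianProduct xs ys) ⟩
  ∑ (cartesianProduct xs ys) (λ ab → indicator (p (proj₁ ab) ∧ q (proj₂ ab)))
    ≡⟨ ∑-cartesianProduct _ xs ys ⟩
  ∑[ a ∈ xs ] ∑[ b ∈ ys ] indicator (p a ∧ q b)
    ≡⟨ ∑-cong xs (λ {a} _ → trans (∑-cong ys (λ {b} _ → indicator-∧ (p a) (q b))) (∑-*ˡ (indicator (p a)) _ ys)) ⟩
  ∑[ a ∈ xs ] (indicator (p a) * (∑[ b ∈ ys ] indicator (q b)))
    ≡⟨ ∑-*ʳ _ (λ a → indicator (p a)) xs ⟩
  (∑[ a ∈ xs ] indicator (p a)) * (∑[ b ∈ ys ] indicator (q b))
    ≡⟨ sym (cong₂ _*_ (count-as-∑ p xs) (count-as-∑ q ys)) ⟩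
  countᵇ p xs * countᵇ q ys ∎
  where open ≡-Reasoning

module _ {B : Set} (_==_ : B → B → Bool) where

  pointwiseᵇ : ∀ k → (Fin k → B) → (Fin k → B) → Bool
  pointwiseᵇ zero f g = true
  pointwiseᵇ (suc k) f g = (f zero == g zero) ∧ pointwiseᵇ k (λ i → f (suc i)) (λ i → g (suc i))

  pointwiseᵇ-elim : ∀ k f g → pointwiseᵇ k f g ≡ true → ∀ i → (f i == g i) ≡ true
  pointwiseᵇ-elim (suc k) f g h zero = ∧-elimˡ h
  pointwiseᵇ-elim (suc k) f g h (suc i) = pointwiseᵇ-elim k _ _ (∧-elimʳ {f zero == g zero} h) i

  pointwiseᵇ-intro : ∀ k f g → (∀ i → (f i == g i) ≡ true) → pointwiseᵇ k f g ≡ true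
  pointwiseᵇ-intro zero f g h = refl
  pointwiseᵇ-intro (suc k) f g h = h zero & pointwiseᵇ-intro k _ _ (λ i → h (suc i))

  count-pointwise-funs : ∀ bs → (∀ b → countᵇ (_== b) bs ≡ 1)
                       → ∀ k g → countᵇ (λ f → pointwiseᵇ k f g) (funs k bs) ≡ 1
  count-pointwise-funs bs once zero g = refl
  count-pointwise-funs bs once (suc k) g = begin
    countᵇ (λ f → pointwiseᵇ (suc k) f g) (funs (suc k) bs)
      ≡⟨ count-as-∑ _ (funs (suc k) bs) ⟩
    ∑ (concatMap (λ b → map (consF b) (funs k bs)) bs) (λ f → indicator (pointwiseᵇ (suc k) f g))
      ≡⟨ ∑-concatMap _ _ bs ⟩
    ∑[ b ∈ bs ] ∑ (map (consF b) (funs k bs)) (λ f → indicator (pointwiseᵇ (suc k) f g))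
      ≡⟨ ∑-cong bs (λ {b} _ → trans (∑-map _ (consF b) (funs k bs)) (sym (count-as-∑ _ (funs k bs)))) ⟩
    ∑[ b ∈ bs ] countᵇ (λ f → (b == g zero) ∧ pointwiseᵇ k f g₊) (funs k bs)
      ≡⟨ ∑-cong bs (λ {b} _ → trans (count-∧ˡ (b == g zero) _ (funs k bs))
                                    (cong (indicator (b == g zero) *_) (count-pointwise-funs bs once k g₊))) ⟩
    ∑[ b ∈ bs ] (indicator (b == g zero) * 1)
      ≡⟨ ∑-cong bs (λ {b} _ → *-identityʳ _) ⟩
    ∑[ b ∈ bs ] indicator (b == g zero)
      ≡⟨ trans (sym (count-as-∑ _ bs)) (once (g zero)) ⟩
    1 ∎
    where
    open ≡-Reasoning
    g₊ = λ i → g (suc i)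

funs-complete : ∀ {B : Set} (R : B → B → Set) (bs : List B) → (∀ b → ∃ λ b' → b' ∈ bs × R b' b)
  → ∀ k (g : Fin k → B) → ∃ λ f → f ∈ funs k bs × (∀ i → R (f i) (g i))
funs-complete R bs hb zero g = (λ ()) , here refl , (λ ())
funs-complete R bs hb (suc k) g with hb (g zero) | funs-complete R bs hb k (λ i → g (suc i))
... | b' , mb , rb | f , mf , rf =
  consF b' f , ∈-concatMap⁺ (λ b → map (consF b) (funs k bs)) (Any.map (λ { refl → ∈-map⁺ (consF b') mf }) mb)
             , λ { zero → rb ; (suc i) → rf i }

module _ {n : ℕ} where

  sameRelᵇ : Rel₂ n → Rel₂ n → Bool
  sameRelᵇ = pointwiseᵇ (pointwiseᵇ _⇔ᵇ_ n) n

  sameRelᵇ-elim : ∀ R R' → sameRelᵇ R R' ≡ true → ∀ i j → R i j ≡ R' i j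
  sameRelᵇ-elim R R' h i j =
    ⇔ᵇ⇒≡ (pointwiseᵇ-elim _⇔ᵇ_ n (R i) (R' i) (pointwiseᵇ-elim (pointwiseᵇ _⇔ᵇ_ n) n R R' h i) j)

  sameRelᵇ-intro : ∀ R R' → (∀ i j → R i j ≡ R' i j) → sameRelᵇ R R' ≡ true
  sameRelᵇ-intro R R' h =
    pointwiseᵇ-intro (pointwiseᵇ _⇔ᵇ_ n) n R R' (λ i → pointwiseᵇ-intro _⇔ᵇ_ n (R i) (R' i) (λ j → ≡⇒⇔ᵇ (h i j)))

  count-sameRel : ∀ R → countᵇ (λ R' → sameRelᵇ R' R) (allRel n) ≡ 1
  count-sameRel = count-pointwise-funs _ (funs n (true ∷ false ∷ []))
                    (count-pointwise-funs _⇔ᵇ_ (true ∷ false ∷ []) (λ { true → refl ; false → refl }) n) n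

  allRel-complete : ∀ R → ∃ λ R' → R' ∈ allRel n × (∀ i j → R' i j ≡ R i j)
  allRel-complete R with count≡suc⇒∃ (λ R' → sameRelᵇ R' R) (allRel n) (count-sameRel R)
  ... | R' , m , e = R' , m , sameRelᵇ-elim R' R e

  maps-complete : ∀ k (φ : Fin k → Fin n) → ∃ λ ψ → ψ ∈ funs k (allFin n) × (∀ i → ψ i ≡ φ i)
  maps-complete = funs-complete _≡_ (allFin n) (λ b → b , ∈-allFin b , refl)

-- AM-GM

private
  gap-identity : ∀ a x t u → a * (x + u) + (a + t) * x + t * u ≡ a * x + (a + t) * (x + u)
  gap-identity = solve-∀

  gap-identity′ : ∀ a x b y t u → a + t ≡ b → x + u ≡ y → a * y + b * x + t * u ≡ a * x + b * y
  gap-identity′ a x _ _ t u refl refl = gap-identity a x t u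

rearrangement-gap : ∀ m a b → a ≤ b → a * b ^ m + b * a ^ m + (b ∸ a) * (b ^ m ∸ a ^ m) ≡ a ^ suc m + b ^ suc m
rearrangement-gap m a b a≤b =
  gap-identity′ a (a ^ m) b (b ^ m) (b ∸ a) (b ^ m ∸ a ^ m) (m+[n∸m]≡n a≤b) (m+[n∸m]≡n (^-monoˡ-≤ m a≤b))

rearrangement-≤ : ∀ m a b → a ≤ b → a * b ^ m + b * a ^ m ≤ a ^ suc m + b ^ suc m
rearrangement-≤ m a b a≤b = subst (a * b ^ m + b * a ^ m ≤_) (rearrangement-gap m a b a≤b) (m≤m+n _ _)

rearrangement : ∀ m a b → a * b ^ m + b * a ^ m ≤ a ^ suc m + b ^ suc m
rearrangement m a b with ≤-total a b
... | inj₁ a≤b = rearrangement-≤ m a b a≤b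
... | inj₂ b≤a = subst₂ _≤_ (+-comm (b * a ^ m) _) (+-comm (b ^ suc m) _) (rearrangement-≤ m b a b≤a)

rearrangement-< : ∀ m a b → a < b → a * b ^ suc m + b * a ^ suc m < a ^ suc (suc m) + b ^ suc (suc m)
rearrangement-< m a b a<b = subst (a * b ^ suc m + b * a ^ suc m <_) (rearrangement-gap (suc m) a b (<⇒≤ a<b))
  (m<m+n _ (*-mono-< (m<n⇒0<n∸m a<b) (m<n⇒0<n∸m (^-monoˡ-< (suc m) a<b))))

rearrangement-≢ : ∀ m a b → ¬ (a ≡ b) → a * b ^ suc m + b * a ^ suc m < a ^ suc (suc m) + b ^ suc (suc m)
rearrangement-≢ m a b a≢b with <-cmp a b
... | tri< a<b _ _ = rearrangement-< m a b a<b
... | tri≈ _ a≡b _ = ⊥-elim (a≢b a≡b)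
... | tri> _ _ b<a = subst₂ _<_ (+-comm (b * a ^ suc m) _) (+-comm (b ^ suc (suc m)) _) (rearrangement-< m b a b<a)

private
  base-identity : ∀ a → 1 * a * 1 ≡ a * 1 + 0 * (a * 1)
  base-identity = solve-∀
  split-identity : ∀ k a b bk → suc (suc k) * a * (b * bk) ≡ b * (suc k * a * bk) + a * (b * bk)
  split-identity = solve-∀
  regroup-identity : ∀ k a b ak1 bk → b * (ak1 + k * (b * bk)) + a * (b * bk) ≡ (a * (b * bk) + b * ak1) + k * (b * (b * bk))
  regroup-identity = solve-∀
  merge-identity : ∀ k X Y → X + Y + k * Y ≡ X + suc k * Y
  merge-identity = solve-∀

weighted-amgm : ∀ k a b → suc k * a * b ^ k ≤ a ^ suc k + k * b ^ suc k

weighted-amgm-step : ∀ k a b → suc (suc k) * a * b ^ suc k ≤ (a * b ^ suc k + b * a ^ suc k) + k * b ^ suc (suc k)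
weighted-amgm-step k a b = begin
  suc (suc k) * a * (b * b ^ k)                              ≡⟨ split-identity k a b (b ^ k) ⟩
  b * (suc k * a * b ^ k) + a * (b * b ^ k)                  ≤⟨ +-monoˡ-≤ _ (*-monoʳ-≤ b (weighted-amgm k a b)) ⟩
  b * (a ^ suc k + k * (b * b ^ k)) + a * (b * b ^ k)        ≡⟨ regroup-identity k a b (a ^ suc k) (b ^ k) ⟩
  (a * (b * b ^ k) + b * a ^ suc k) + k * (b * (b * b ^ k))  ∎
  where open ≤-Reasoning

weighted-amgm zero a b = ≤-reflexive (base-identity a)
weighted-amgm (suc k) a b = begin
  suc (suc k) * a * b ^ suc k                     ≤⟨ weighted-amgm-step k a b ⟩
  (a * b ^ suc k + b * a ^ suc k) + k * b ^ suc (suc k)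
                                                  ≤⟨ +-monoˡ-≤ _ (rearrangement (suc k) a b) ⟩
  (a ^ suc (suc k) + b ^ suc (suc k)) + k * b ^ suc (suc k)
                                                  ≡⟨ merge-identity k _ _ ⟩
  a ^ suc (suc k) + suc k * b ^ suc (suc k)       ∎
  where open ≤-Reasoning

weighted-amgm-≢ : ∀ k a b → ¬ (a ≡ b) → suc (suc k) * a * b ^ suc k < a ^ suc (suc k) + suc k * b ^ suc (suc k)
weighted-amgm-≢ k a b a≢b = begin-strict
  suc (suc k) * a * b ^ suc k                     ≤⟨ weighted-amgm-step k a b ⟩
  (a * b ^ suc k + b * a ^ suc k) + k * b ^ suc (suc k)
                                                  <⟨ +-monoˡ-< _ (rearrangement-≢ k a b a≢b) ⟩
  (a ^ suc (suc k) + b ^ suc (suc k)) + k * b ^ suc (suc k)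
                                                  ≡⟨ merge-identity k _ _ ⟩
  a ^ suc (suc k) + suc k * b ^ suc (suc k)       ∎
  where open ≤-Reasoning

module _ {A : Set} (f : A → ℕ) where

  private
    factor-identity : ∀ m a P → m * (suc m * (a * P)) ≡ suc m * a * (m * P)
    factor-identity = solve-∀
    single-identity : ∀ a → 1 * (a * 1) ≡ a * 1 + 0
    single-identity = solve-∀

  -- The three links of the inductive step for y ∷ ys, multiplied by m = length ys; the equality
  -- case reuses them to force equality in weighted-amgm.
  amgm-chain : ∀ y ys → let m = length ys in
    m * product (map f ys) ≤ ∑[ x ∈ ys ] f x ^ m →
    (m * (suc m * product (map f (y ∷ ys))) ≤ ∑[ x ∈ ys ] (suc m * f y * f x ^ m)) ×
    (∀ {x} → x ∈ ys → suc m * f y * f x ^ m ≤ f y ^ suc m + m * f x ^ suc m) ×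
    (∑[ x ∈ ys ] (f y ^ suc m + m * f x ^ suc m) ≡ m * (∑[ x ∈ (y ∷ ys) ] f x ^ suc m))
  amgm-chain y ys ih = lower , (λ {x} _ → weighted-amgm m (f y) (f x)) , upper
    where
    m = length ys
    lower = begin
      m * (suc m * (f y * product (map f ys)))  ≡⟨ factor-identity m (f y) _ ⟩
      suc m * f y * (m * product (map f ys))    ≤⟨ *-monoʳ-≤ (suc m * f y) ih ⟩
      suc m * f y * (∑[ x ∈ ys ] f x ^ m)       ≡⟨ sym (∑-*ˡ (suc m * f y) (λ x → f x ^ m) ys) ⟩
      ∑[ x ∈ ys ] (suc m * f y * f x ^ m)       ∎
      where open ≤-Reasoning
    upper = begin
      ∑[ x ∈ ys ] (f y ^ suc m + m * f x ^ suc m)          ≡⟨ ∑-+ (λ _ → f y ^ suc m) (λ x → m * f x ^ suc m) ys ⟩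
      (∑[ _ ∈ ys ] f y ^ suc m) + (∑[ x ∈ ys ] m * f x ^ suc m) ≡⟨ cong₂ _+_ (∑-const _ ys) (∑-*ˡ m (λ x → f x ^ suc m) ys) ⟩
      m * f y ^ suc m + m * (∑[ x ∈ ys ] f x ^ suc m)       ≡⟨ sym (*-distribˡ-+ m _ _) ⟩
      m * (∑[ x ∈ (y ∷ ys) ] f x ^ suc m)                     ∎
      where open ≡-Reasoning

  amgm : ∀ xs → length xs * product (map f xs) ≤ ∑[ x ∈ xs ] f x ^ length xs
  amgm [] = z≤n
  amgm (y ∷ []) = ≤-reflexive (single-identity (f y))
  amgm (y ∷ ys@(_ ∷ _)) with amgm-chain y ys (amgm ys)
  ... | lower , pointwise , upper =
    *-cancelˡ-≤ (length ys) (≤-trans lower (≤-trans (∑-mono-≤ ys pointwise) (≤-reflexive upper)))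

  amgm-equality-head : ∀ y ys → length (y ∷ ys) * product (map f (y ∷ ys)) ≡ ∑[ x ∈ (y ∷ ys) ] f x ^ length (y ∷ ys)
                     → ∀ {x} → x ∈ y ∷ ys → f x ≡ f y
  amgm-equality-head y ys eq (here refl) = refl
  amgm-equality-head y ys@(_ ∷ ys′) eq {x} (there x∈ys) with amgm-chain y ys (amgm ys)
  ... | lower , pointwise , upper with f x ≟ f y
  ...   | yes fx≡fy = fx≡fy
  ...   | no fx≢fy = ⊥-elim (<-irrefl (tight x∈ys) (weighted-amgm-≢ (length ys′) (f y) (f x) (λ e → fx≢fy (sym e))))
    where
    tight = ∑-tight ys pointwise (≤-trans (≤-reflexive (trans upper (cong (length ys *_) (sym eq)))) lower)

  amgm-equality : ∀ xs → length xs * product (map f xs) ≡ ∑[ x ∈ xs ] f x ^ length xs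
                → ∀ {u w} → u ∈ xs → w ∈ xs → f u ≡ f w
  amgm-equality (y ∷ ys) eq u∈ w∈ = trans (amgm-equality-head y ys eq u∈) (sym (amgm-equality-head y ys eq w∈))

-- F-free relations

_∪ᵣ_ : ∀ {n} → Rel₂ n → Rel₂ n → Rel₂ n
(R₁ ∪ᵣ R₂) i j = R₁ i j ∨ R₂ i j

module _ {k n : ℕ} where

  injectiveᵇ : (Fin k → Fin n) → Bool
  injectiveᵇ φ = allᶠ λ i → allᶠ λ j → not (φ i ≟ᵇ φ j) ∨ (i ≟ᵇ j)

  arcsPreservedᵇ : Rel₂ k → Rel₂ n → (Fin k → Fin n) → Bool
  arcsPreservedᵇ T R φ = allᶠ λ i → allᶠ λ j → not (T i j) ∨ R (φ i) (φ j)

  embeds-arc : ∀ (T : Rel₂ k) (R : Rel₂ n) φ → embedsᵇ T R φ ≡ true → ∀ i j → T i j ≡ true → R (φ i) (φ j) ≡ true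
  embeds-arc T R φ h i j = ⇒ᵇ-elim (allᶠ²-elim (λ i j → not (T i j) ∨ R (φ i) (φ j)) (∧-elimʳ {injectiveᵇ φ} h) i j)

  embeds-transfer : ∀ (T : Rel₂ k) (R R' : Rel₂ n) φ → embedsᵇ T R φ ≡ true → (∀ i j → T i j ≡ true → R' (φ i) (φ j) ≡ true)
                  → embedsᵇ T R' φ ≡ true
  embeds-transfer T R R' φ h arcs = ∧-elimˡ h & allᶠ²-intro _ (λ i j → ⇒ᵇ-intro (arcs i j))

  embeds-cong : ∀ (T : Rel₂ k) (R : Rel₂ n) φ ψ → (∀ i → φ i ≡ ψ i) → embedsᵇ T R φ ≡ embedsᵇ T R ψ
  embeds-cong T R φ ψ e =
    cong₂ _∧_ (allᶠ²-cong (λ i j → cong₂ (λ a b → not (a ≟ᵇ b) ∨ (i ≟ᵇ j)) (e i) (e j)))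
              (allᶠ²-cong (λ i j → cong₂ (λ a b → not (T i j) ∨ R a b) (e i) (e j)))

  embeds-injective : ∀ (T : Rel₂ k) (R : Rel₂ n) φ → embedsᵇ T R φ ≡ true → ∀ i j → φ i ≡ φ j → i ≡ j
  embeds-injective T R φ h i j e =
    ≟ᵇ⇒≡ (⇒ᵇ-elim (allᶠ²-elim (λ i j → not (φ i ≟ᵇ φ j) ∨ (i ≟ᵇ j)) (∧-elimˡ h) i j)
                  (subst (λ z → (φ i ≟ᵇ z) ≡ true) e (≟ᵇ-refl (φ i))))

module _ {n : ℕ} (F : Family) where

  -- A copy in R of a member T of F, together with the positions of k, T and φ in the search
  -- performed by containsᵇ, so that a copy in another relation can be recognised by it.
  record Copy (R : Rel₂ n) : Set where
    field
      k : ℕ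
      k∈ : k ∈ upTo (Data.Nat.suc n)
      T : Rel₂ k
      T∈ : T ∈ allRel k
      T∈F : F k T ≡ true
      φ : Fin k → Fin n
      φ∈ : φ ∈ funs k (allFin n)
      embeds : embedsᵇ T R φ ≡ true

  copy : ∀ (R : Rel₂ n) → containsᵇ F R ≡ true → Copy R
  copy R h with any-elim _ (upTo (Data.Nat.suc n)) h
  ... | k , k∈ , h₁ with any-elim _ (allRel k) h₁
  ... | T , T∈ , h₂ with any-elim _ (funs k (allFin n)) (∧-elimʳ {F k T} h₂)
  ... | φ , φ∈ , h₃ =
    record { k = k ; k∈ = k∈ ; T = T ; T∈ = T∈ ; T∈F = ∧-elimˡ h₂ ; φ = φ ; φ∈ = φ∈ ; embeds = h₃ }

  contains-copy : ∀ {R} (c : Copy R) (R' : Rel₂ n) ψ → ψ ∈ funs (Copy.k c) (allFin n) → embedsᵇ (Copy.T c) R' ψ ≡ true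
                → containsᵇ F R' ≡ true
  contains-copy c R' ψ ψ∈ e =
    any-intro _ (Copy.k∈ c) (any-intro _ (Copy.T∈ c) (Copy.T∈F c & any-intro _ ψ∈ e))

  contains-cong : ∀ (R R' : Rel₂ n) → (∀ i j → R i j ≡ R' i j) → containsᵇ F R ≡ containsᵇ F R'
  contains-cong R R' e =
    any-cong (upTo (Data.Nat.suc n)) λ k → any-cong (allRel k) λ T → cong (F k T ∧_) (any-cong (funs k (allFin n)) λ φ →
      cong (injectiveᵇ φ ∧_) (allᶠ²-cong (λ i j → cong (not (T i j) ∨_) (e (φ i) (φ j)))))

  free-cong : ∀ (R R' : Rel₂ n) → (∀ i j → R i j ≡ R' i j) → freeᵇ F R ≡ freeᵇ F R'
  free-cong R R' e = cong not (contains-cong R R' e)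

  free-by : ∀ (R : Rel₂ n) → (containsᵇ F R ≡ true → ⊥) → freeᵇ F R ≡ true
  free-by R h = cong not (≢true⇒≡false h)

  not-free : ∀ {R : Rel₂ n} → freeᵇ F R ≡ true → containsᵇ F R ≡ true → ⊥
  not-free f c = true≢false (trans (sym f) (cong not c))

  free-antimono : ∀ (R R' : Rel₂ n) → (∀ i j → R' i j ≡ true → R i j ≡ true) → freeᵇ F R ≡ true → freeᵇ F R' ≡ true
  free-antimono R R' R'⊆R free = free-by R' λ h → not-free {R} free (shift (copy R' h))
    where
    shift : Copy R' → containsᵇ F R ≡ true
    shift c = contains-copy c R φ φ∈
      (embeds-transfer T R' R φ embeds (λ i j t → R'⊆R (φ i) (φ j) (embeds-arc T R' φ embeds i j t)))
      where open Copy c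

  -- A copy through φ in R becomes a copy through σ ∘ φ in R relabelled by σ.
  free-relabel : (σ : Fin n → Fin n) → (∀ i → σ (σ i) ≡ i) → ∀ (R : Rel₂ n) → freeᵇ F (λ i j → R (σ i) (σ j)) ≡ freeᵇ F R
  free-relabel σ inv R = cong not (true-ext back (transport R))
    where
    transport : ∀ (Q : Rel₂ n) → containsᵇ F Q ≡ true → containsᵇ F (λ i j → Q (σ i) (σ j)) ≡ true
    transport Q h = contains-copy c (λ i j → Q (σ i) (σ j)) ψ ψ∈
      (trans (embeds-cong T (λ i j → Q (σ i) (σ j)) ψ (λ i → σ (φ i)) ψ≗) σφ-embeds)
      where
      c = copy Q h
      open Copy c
      ψ = proj₁ (maps-complete k (λ i → σ (φ i)))
      ψ∈ = proj₁ (proj₂ (maps-complete k (λ i → σ (φ i))))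
      ψ≗ = proj₂ (proj₂ (maps-complete k (λ i → σ (φ i))))
      σφ-injective : ∀ i j → (not (σ (φ i) ≟ᵇ σ (φ j)) ∨ (i ≟ᵇ j)) ≡ true
      σφ-injective i j = ⇒ᵇ-intro λ eq → subst (λ z → (i ≟ᵇ z) ≡ true)
        (embeds-injective T Q φ embeds i j (trans (sym (inv (φ i))) (trans (cong σ (≟ᵇ⇒≡ eq)) (inv (φ j)))))
        (≟ᵇ-refl i)
      σφ-embeds : embedsᵇ T (λ i j → Q (σ i) (σ j)) (λ i → σ (φ i)) ≡ true
      σφ-embeds = allᶠ²-intro _ σφ-injective
                & allᶠ²-intro _ (λ i j → ⇒ᵇ-intro λ t → trans (cong₂ Q (inv (φ i)) (inv (φ j))) (embeds-arc T Q φ embeds i j t))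
    back : containsᵇ F (λ i j → R (σ i) (σ j)) ≡ true → containsᵇ F R ≡ true
    back h = trans (sym (contains-cong _ R (λ i j → cong₂ R (inv i) (inv j)))) (transport (λ i j → R (σ i) (σ j)) h)

  -- The last hypothesis makes every copy in R₁ ∪ᵣ R₂ lie entirely in R₁ or entirely in R₂.
  free-∪ : ∀ (R₁ R₂ : Rel₂ n) → freeᵇ F R₁ ≡ true → freeᵇ F R₂ ≡ true
         → (∀ {k} (T : Rel₂ k) → F k T ≡ true → (φ : Fin k → Fin n)
              → (∀ i j → T i j ≡ true → (R₁ ∪ᵣ R₂) (φ i) (φ j) ≡ true)
              → ∀ i j i′ j′ → R₁ (φ i) (φ j) ≡ true → R₂ (φ i) (φ j) ≡ false
              → R₂ (φ i′) (φ j′) ≡ true → R₁ (φ i′) (φ j′) ≡ false → ⊥)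
         → freeᵇ F (R₁ ∪ᵣ R₂) ≡ true
  free-∪ R₁ R₂ free₁ free₂ unmixed = free-by (R₁ ∪ᵣ R₂) λ h → split (copy (R₁ ∪ᵣ R₂) h)
    where
    one-side : ∀ {k} (T : Rel₂ k) {φ : Fin k → Fin n}
             → (∀ i j i′ j′ → R₁ (φ i) (φ j) ≡ true → R₂ (φ i) (φ j) ≡ false
                  → R₂ (φ i′) (φ j′) ≡ true → R₁ (φ i′) (φ j′) ≡ false → ⊥)
             → (∀ i j → T i j ≡ true → (R₁ ∪ᵣ R₂) (φ i) (φ j) ≡ true)
             → (∀ i j → T i j ≡ true → R₁ (φ i) (φ j) ≡ true) ⊎ (∀ i j → T i j ≡ true → R₂ (φ i) (φ j) ≡ true)
    one-side T {φ} mixed arcs with arcsPreservedᵇ T R₁ φ in all₁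
    ... | true = inj₁ λ i j → ⇒ᵇ-elim (allᶠ²-elim (λ i j → not (T i j) ∨ R₁ (φ i) (φ j)) all₁ i j)
    ... | false = inj₂ in₂
      where
      row = allᶠ-false (λ i → allᶠ λ j → not (T i j) ∨ R₁ (φ i) (φ j)) all₁
      i₀ = proj₁ row
      entry = allᶠ-false (λ j → not (T i₀ j) ∨ R₁ (φ i₀) (φ j)) (proj₂ row)
      j₀ = proj₁ entry
      t₀ : T i₀ j₀ ≡ true
      t₀ = proj₁ (⇒ᵇ-false (proj₂ entry))
      r₁₀ : R₁ (φ i₀) (φ j₀) ≡ false
      r₁₀ = proj₂ (⇒ᵇ-false (proj₂ entry))
      ∨-false : ∀ {a} → (a ∨ false) ≡ true → a ≡ true
      ∨-false {true} _ = refl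
      in₂ : ∀ i j → T i j ≡ true → R₂ (φ i) (φ j) ≡ true
      in₂ i j t with R₂ (φ i) (φ j) in r₂
      ... | true = refl
      ... | false = ⊥-elim (mixed i j i₀ j₀ (∨-false (subst (λ b → (R₁ (φ i) (φ j) ∨ b) ≡ true) r₂ (arcs i j t)))
                                  r₂ (subst (λ b → (b ∨ R₂ (φ i₀) (φ j₀)) ≡ true) r₁₀ (arcs i₀ j₀ t₀)) r₁₀)
    split : Copy (R₁ ∪ᵣ R₂) → ⊥
    split c = [ inside {R₁} free₁ , inside {R₂} free₂ ] (one-side T {φ} (unmixed T T∈F φ arcs) arcs)
      where
      open Copy c
      arcs = embeds-arc T (R₁ ∪ᵣ R₂) φ embeds
      inside : ∀ {R : Rel₂ n} → freeᵇ F R ≡ true → (∀ i j → T i j ≡ true → R (φ i) (φ j) ≡ true) → ⊥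
      inside {R} free a = not-free {R} free (contains-copy c R φ φ∈ (embeds-transfer T (R₁ ∪ᵣ R₂) R φ embeds a))

-- The conditions of isOrientationOn and agreeOn at a single pair (i , j): here w w′ u u′ are the
-- memberships of i and j, e = adj G i j, and r r′ = R i j , R j i.

orientCell : Bool → Bool → Bool → Bool → Bool → Bool
orientCell w w′ e r r′ = if w ∧ w′ ∧ e then r xor r′ else not r

agreeCell : Bool → Bool → Bool → Bool → Bool
agreeCell u u′ r h = not (u ∧ u′) ∨ not (r xor h)

orientCell-congᵉ : ∀ w w′ {e e′} r r′ → (w ≡ true → w′ ≡ true → e ≡ e′) → orientCell w w′ e r r′ ≡ orientCell w w′ e′ r r′
orientCell-congᵉ true true r r′ f = cong (λ e → orientCell true true e r r′) (f refl refl)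
orientCell-congᵉ true false r r′ f = refl
orientCell-congᵉ false w′ r r′ f = refl

agreeCell-congʳ : ∀ u u′ {r r′} h → (u ≡ true → u′ ≡ true → r ≡ r′) → agreeCell u u′ r h ≡ agreeCell u u′ r′ h
agreeCell-congʳ true true h f = cong (λ r → agreeCell true true r h) (f refl refl)
agreeCell-congʳ true false h f = refl
agreeCell-congʳ false u′ h f = refl

orientCell-restrict : ∀ u u′ w w′ e r r′ →
  ((u ⇒ᵇ w) ∧ (u′ ⇒ᵇ w′) ∧ orientCell w w′ e r r′ ⇒ᵇ orientCell u u′ e (u ∧ u′ ∧ r) (u′ ∧ u ∧ r′)) ≡ true
orientCell-restrict = valid-sound 7 _ refl

agreeCell-restrict : ∀ u u′ a a′ r h →
  ((u ⇒ᵇ a) ∧ (u′ ⇒ᵇ a′) ∧ agreeCell u u′ r h ⇒ᵇ agreeCell u u′ (a ∧ a′ ∧ r) h) ≡ true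
agreeCell-restrict = valid-sound 6 _ refl

agreeCell-restriction : ∀ u u′ r → agreeCell u u′ r (u ∧ u′ ∧ r) ≡ true
agreeCell-restriction = valid-sound 3 _ refl

agreeCell-refl : ∀ u u′ h → agreeCell u u′ h h ≡ true
agreeCell-refl = valid-sound 3 _ refl

agreeCell-restriction-unique : ∀ u u′ e h h′ r →
  (orientCell u u′ e h h′ ∧ agreeCell u u′ r h ⇒ᵇ (h ⇔ᵇ (u ∧ u′ ∧ r))) ≡ true
agreeCell-restriction-unique = valid-sound 6 _ refl

agreeCell-unique : ∀ u u′ e r r′ h h′ →
  (orientCell u u′ e r r′ ∧ orientCell u u′ e h h′ ∧ agreeCell u u′ r h ⇒ᵇ (r ⇔ᵇ h)) ≡ true
agreeCell-unique = valid-sound 7 _ refl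

agreeCell-trans : ∀ u u′ r₁ r₂ h → (agreeCell u u′ r₁ h ∧ agreeCell u u′ r₂ h ⇒ᵇ (u ∧ u′ ⇒ᵇ (r₁ ⇔ᵇ r₂))) ≡ true
agreeCell-trans = valid-sound 5 _ refl

agreeCell-∪ : ∀ u u′ r₁ r₂ h → (agreeCell u u′ r₁ h ∧ agreeCell u u′ r₂ h ⇒ᵇ agreeCell u u′ (r₁ ∨ r₂) h) ≡ true
agreeCell-∪ = valid-sound 5 _ refl

orientCell-arc : ∀ w w′ e r r′ → (orientCell w w′ e r r′ ∧ r ⇒ᵇ w ∧ w′ ∧ e) ≡ true
orientCell-arc = valid-sound 5 _ refl

-- Gluing orientations of A and B along U, where a a′ b b′ u u′ are the memberships of i and j.
-- The hypotheses: U = A ∩ B, R₁ and R₂ agree on U, and there is no edge between A ∖ U and B ∖ U.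

orientCell-∪ : ∀ a a′ b b′ u u′ e r₁ r₁′ r₂ r₂′ →
  (orientCell a a′ e r₁ r₁′ ∧ orientCell a′ a e r₁′ r₁ ∧ orientCell b b′ e r₂ r₂′ ∧ orientCell b′ b e r₂′ r₂
   ∧ (u ∧ u′ ⇒ᵇ (r₁ ⇔ᵇ r₂)) ∧ (u′ ∧ u ⇒ᵇ (r₁′ ⇔ᵇ r₂′))
   ∧ (u ⇒ᵇ a) ∧ (u′ ⇒ᵇ a′) ∧ (u ⇒ᵇ b) ∧ (u′ ⇒ᵇ b′) ∧ (a ∧ b ⇒ᵇ u) ∧ (a′ ∧ b′ ⇒ᵇ u′)
   ∧ (a ∧ b′ ∧ not u ∧ not u′ ⇒ᵇ not e) ∧ (a′ ∧ b ∧ not u′ ∧ not u ⇒ᵇ not e)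
   ⇒ᵇ orientCell (a ∨ b) (a′ ∨ b′) e (r₁ ∨ r₂) (r₁′ ∨ r₂′)) ≡ true
orientCell-∪ = valid-sound 11 _ refl

orientCell-∪-restrict : ∀ a a′ b b′ u u′ e r₁ r₁′ r₂ r₂′ →
  (orientCell a a′ e r₁ r₁′ ∧ orientCell b b′ e r₂ r₂′ ∧ (u ∧ u′ ⇒ᵇ (r₁ ⇔ᵇ r₂)) ∧ (a ∧ b ⇒ᵇ u) ∧ (a′ ∧ b′ ⇒ᵇ u′)
   ⇒ᵇ (r₁ ⇔ᵇ (a ∧ a′ ∧ (r₁ ∨ r₂))) ∧ (r₂ ⇔ᵇ (b ∧ b′ ∧ (r₁ ∨ r₂)))) ≡ true
orientCell-∪-restrict = valid-sound 11 _ refl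

orientCell-split : ∀ a a′ b b′ u u′ e r r′ →
  (orientCell (a ∨ b) (a′ ∨ b′) e r r′ ∧ (u ⇒ᵇ a) ∧ (u′ ⇒ᵇ a′) ∧ (u ⇒ᵇ b) ∧ (u′ ⇒ᵇ b′)
   ∧ (a ∧ b′ ∧ not u ∧ not u′ ⇒ᵇ not e) ∧ (a′ ∧ b ∧ not u′ ∧ not u ⇒ᵇ not e)
   ⇒ᵇ (r ⇔ᵇ ((a ∧ a′ ∧ r) ∨ (b ∧ b′ ∧ r)))) ≡ true
orientCell-split = valid-sound 9 _ refl

orientCell-exclusive-arc : ∀ a a′ u u′ e r r′ s →
  (orientCell a a′ e r r′ ∧ r ∧ not s ∧ (u ∧ u′ ⇒ᵇ (r ⇔ᵇ s)) ⇒ᵇ (a ∧ not u) ∨ (a′ ∧ not u′)) ≡ true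
orientCell-exclusive-arc = valid-sound 8 _ refl

module _ {n : ℕ} where

  agrees-elim : ∀ (U : VSet n) R H → agreeOn U R H ≡ true → ∀ i j → agreeCell (U i) (U j) (R i j) (H i j) ≡ true
  agrees-elim U R H = allᶠ²-elim (λ i j → agreeCell (U i) (U j) (R i j) (H i j))

  agrees-intro : ∀ (U : VSet n) R H → (∀ i j → agreeCell (U i) (U j) (R i j) (H i j) ≡ true) → agreeOn U R H ≡ true
  agrees-intro U R H = allᶠ²-intro (λ i j → agreeCell (U i) (U j) (R i j) (H i j))

  agrees-congˡ : ∀ (U : VSet n) R R′ H → (∀ i j → R i j ≡ R′ i j) → agreeOn U R H ≡ agreeOn U R′ H
  agrees-congˡ U R R′ H e = allᶠ²-cong (λ i j → cong (λ r → agreeCell (U i) (U j) r (H i j)) (e i j))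

  agrees-congʳ : ∀ (U : VSet n) R H H′ → (∀ i j → H i j ≡ H′ i j) → agreeOn U R H ≡ agreeOn U R H′
  agrees-congʳ U R H H′ e = allᶠ²-cong (λ i j → cong (agreeCell (U i) (U j) (R i j)) (e i j))

  restrict : VSet n → Rel₂ n → Rel₂ n
  restrict W R i j = W i ∧ W j ∧ R i j

  restrict-⊆ : ∀ W R i j → restrict W R i j ≡ true → R i j ≡ true
  restrict-⊆ W R i j h = ∧-elimʳ {W j} (∧-elimʳ {W i} h)

  everything : VSet n
  everything _ = true

module _ {n : ℕ} (G : Graph n) where

  orients-elim : ∀ W R → isOrientationOn G W R ≡ true → ∀ i j → orientCell (W i) (W j) (adj G i j) (R i j) (R j i) ≡ true
  orients-elim W R = allᶠ²-elim (λ i j → orientCell (W i) (W j) (adj G i j) (R i j) (R j i))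

  orients-intro : ∀ W R → (∀ i j → orientCell (W i) (W j) (adj G i j) (R i j) (R j i) ≡ true) → isOrientationOn G W R ≡ true
  orients-intro W R = allᶠ²-intro (λ i j → orientCell (W i) (W j) (adj G i j) (R i j) (R j i))

  orients-congʳ : ∀ W R R′ → (∀ i j → R i j ≡ R′ i j) → isOrientationOn G W R ≡ isOrientationOn G W R′
  orients-congʳ W R R′ e = allᶠ²-cong (λ i j → cong₂ (orientCell (W i) (W j) (adj G i j)) (e i j) (e j i))

  orients-congˡ : ∀ W W′ R → (∀ i → W i ≡ W′ i) → isOrientationOn G W R ≡ isOrientationOn G W′ R
  orients-congˡ W W′ R e = allᶠ²-cong (λ i j → cong₂ (λ a b → orientCell a b (adj G i j) (R i j) (R j i)) (e i) (e j))

  restrict-orients : ∀ U W R → (∀ i → (U i ⇒ᵇ W i) ≡ true) → isOrientationOn G W R ≡ true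
                   → isOrientationOn G U (restrict U R) ≡ true
  restrict-orients U W R U⊆W o = orients-intro U (restrict U R) λ i j →
    ⇒ᵇ-elim (orientCell-restrict (U i) (U j) (W i) (W j) (adj G i j) (R i j) (R j i)) (U⊆W i & U⊆W j & orients-elim W R o i j)

module _ {n : ℕ} (F : Family) (G : Graph n) where

  restriction-unique : ∀ U R → isOrientationOn G everything R ≡ true → freeᵇ F R ≡ true
    → ∀ H → ((isOrientationOn G U H ∧ freeᵇ F H) ∧ agreeOn U R H) ≡ sameRelᵇ H (restrict U R)
  restriction-unique U R o free H = true-ext to from
    where
    to : ((isOrientationOn G U H ∧ freeᵇ F H) ∧ agreeOn U R H) ≡ true → sameRelᵇ H (restrict U R) ≡ true
    to h = sameRelᵇ-intro H (restrict U R) λ i j → ⇔ᵇ⇒≡ (⇒ᵇ-elim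
      (agreeCell-restriction-unique (U i) (U j) (adj G i j) (H i j) (H j i) (R i j))
      (orients-elim G U H (∧-elimˡ (∧-elimˡ h)) i j & agrees-elim U R H (∧-elimʳ {isOrientationOn G U H ∧ freeᵇ F H} h) i j))
    from : sameRelᵇ H (restrict U R) ≡ true → ((isOrientationOn G U H ∧ freeᵇ F H) ∧ agreeOn U R H) ≡ true
    from h = (trans (orients-congʳ G U H _ H≗) (restrict-orients G U everything R (λ _ → ⇒ᵇ-intro λ _ → refl) o)
             & trans (free-cong F H _ H≗) (free-antimono F R (restrict U R) (restrict-⊆ U R) free))
           & trans (agrees-congʳ U R H _ H≗) (agrees-intro U R _ λ i j → agreeCell-restriction (U i) (U j) (R i j))
      where
      H≗ = sameRelᵇ-elim H (restrict U R) h

  -- #extensions U H (addV U x) is cF F G U x H, the paper's c_F(x, H) for H = G[U].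
  extendsᵇ : VSet n → Rel₂ n → VSet n → Rel₂ n → Bool
  extendsᵇ U H W R = isOrientationOn G W R ∧ agreeOn U R H ∧ freeᵇ F R

  #extensions : VSet n → Rel₂ n → VSet n → ℕ
  #extensions U H W = countᵇ (extendsᵇ U H W) (allRel n)

  extends-congʳ : ∀ U H W R R′ → (∀ i j → R i j ≡ R′ i j) → extendsᵇ U H W R ≡ extendsᵇ U H W R′
  extends-congʳ U H W R R′ e =
    cong₂ _∧_ (orients-congʳ G W R R′ e) (cong₂ _∧_ (agrees-congˡ U R R′ H e) (free-cong F R R′ e))

  #extensions-congᵂ : ∀ U H W W′ → (∀ i → W i ≡ W′ i) → #extensions U H W ≡ #extensions U H W′
  #extensions-congᵂ U H W W′ e =
    count-cong (allRel n) (λ R → cong (_∧ (agreeOn U R H ∧ freeᵇ F R)) (orients-congˡ G W W′ R e))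

  Dnum-by-restriction : ∀ U → Dnum F G ≡ ∑[ H ∈ DList F G U ] #extensions U H everything
  Dnum-by-restriction U =
    count-by-fibres (λ R H → extendsᵇ U H everything R) (λ R → isOrientationOn G everything R ∧ freeᵇ F R)
                    (allRel n) (DList F G U) rows
    where
    isFreeOrientation : Rel₂ n → VSet n → Bool
    isFreeOrientation R W = isOrientationOn G W R ∧ freeᵇ F R
    rows : ∀ R → countᵇ (λ H → extendsᵇ U H everything R) (DList F G U) ≡ indicator (isFreeOrientation R everything)
    rows R = begin
      countᵇ (λ H → extendsᵇ U H everything R) (DList F G U)
        ≡⟨ count-filterᵇ (λ H → isFreeOrientation H U) _ (allRel n) ⟩
      countᵇ (λ H → isFreeOrientation H U ∧ extendsᵇ U H everything R) (allRel n)
        ≡⟨ count-cong (allRel n) (λ H → regroup H (isOrientationOn G everything R) (freeᵇ F R) refl refl) ⟩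
      countᵇ (λ H → isFreeOrientation R everything ∧ sameRelᵇ H (restrict U R)) (allRel n)
        ≡⟨ count-∧ˡ (isFreeOrientation R everything) (λ H → sameRelᵇ H (restrict U R)) (allRel n) ⟩
      indicator (isFreeOrientation R everything) * countᵇ (λ H → sameRelᵇ H (restrict U R)) (allRel n)
        ≡⟨ cong (indicator (isFreeOrientation R everything) *_) (count-sameRel (restrict U R)) ⟩
      indicator (isFreeOrientation R everything) * 1
        ≡⟨ *-identityʳ _ ⟩
      indicator (isFreeOrientation R everything) ∎
      where
      open ≡-Reasoning
      regroup : ∀ H o f → isOrientationOn G everything R ≡ o → freeᵇ F R ≡ f
        → (isFreeOrientation H U ∧ (o ∧ agreeOn U R H ∧ f)) ≡ ((o ∧ f) ∧ sameRelᵇ H (restrict U R))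
      regroup H true true o-eq f-eq =
        trans (cong (isFreeOrientation H U ∧_) (∧-identityʳ (agreeOn U R H))) (restriction-unique U R o-eq f-eq H)
      regroup H true false _ _ = trans (cong (isFreeOrientation H U ∧_) (∧-zeroʳ (agreeOn U R H))) (∧-zeroʳ _)
      regroup H false f _ _ = ∧-zeroʳ (isFreeOrientation H U)

  #extensions-congᴴ : ∀ U H H′ W → (∀ i j → H i j ≡ H′ i j) → #extensions U H W ≡ #extensions U H′ W
  #extensions-congᴴ U H H′ W e =
    count-cong (allRel n) (λ R → cong (λ a → isOrientationOn G W R ∧ a ∧ freeᵇ F R) (agrees-congʳ U R H H′ e))

-- Extensions of H from U to A ∪ B are pairs of extensions to A and to B, provided U = A ∩ B, there
-- is no edge between A ∖ U and B ∖ U, and F consists of tournaments (a copy of a tournament in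
-- the union cannot meet both A ∖ U and B ∖ U, so it lies in one of the two extensions).

module Gluing {n : ℕ} (F : Family) (tournaments : ∀ k (T : Rel₂ k) → F k T ≡ true → IsTournament T)
              (G : Graph n) (U : VSet n) (H : Rel₂ n) (A B : VSet n)
              (U⊆A : ∀ i → (U i ⇒ᵇ A i) ≡ true) (U⊆B : ∀ i → (U i ⇒ᵇ B i) ≡ true)
              (A∩B⊆U : ∀ i → (A i ∧ B i ⇒ᵇ U i) ≡ true)
              (no-edge : ∀ i j → (A i ∧ B j ∧ not (U i) ∧ not (U j) ⇒ᵇ not (adj G i j)) ≡ true) where

  extends : VSet n → Rel₂ n → Bool
  extends = extendsᵇ F G U H

  A∪B : VSet n
  A∪B i = A i ∨ B i

  no-edge′ : ∀ i j → (A j ∧ B i ∧ not (U j) ∧ not (U i) ⇒ᵇ not (adj G i j)) ≡ true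
  no-edge′ i j = subst (λ e → (A j ∧ B i ∧ not (U j) ∧ not (U i) ⇒ᵇ not e) ≡ true) (Graph.sym G j i) (no-edge j i)

  module _ (W : VSet n) (R : Rel₂ n) (ext : extends W R ≡ true) where
    extends-orients : ∀ i j → orientCell (W i) (W j) (adj G i j) (R i j) (R j i) ≡ true
    extends-orients = orients-elim G W R (∧-elimˡ ext)

    extends-agrees : ∀ i j → agreeCell (U i) (U j) (R i j) (H i j) ≡ true
    extends-agrees = agrees-elim U R H (∧-elimˡ (∧-elimʳ {isOrientationOn G W R} ext))

    extends-free : freeᵇ F R ≡ true
    extends-free = ∧-elimʳ {agreeOn U R H} (∧-elimʳ {isOrientationOn G W R} ext)

    extends-orients′ : ∀ i j → orientCell (W j) (W i) (adj G i j) (R j i) (R i j) ≡ true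
    extends-orients′ i j = subst (λ e → orientCell (W j) (W i) e (R j i) (R i j) ≡ true) (Graph.sym G j i) (extends-orients j i)

  module Union (R₁ R₂ : Rel₂ n) (ext₁ : extends A R₁ ≡ true) (ext₂ : extends B R₂ ≡ true) where

    orient₁ = extends-orients A R₁ ext₁
    orient₂ = extends-orients B R₂ ext₂
    agree₁ = extends-agrees A R₁ ext₁
    agree₂ = extends-agrees B R₂ ext₂

    agree₁₂ : ∀ i j → (U i ∧ U j ⇒ᵇ (R₁ i j ⇔ᵇ R₂ i j)) ≡ true
    agree₁₂ i j = ⇒ᵇ-elim (agreeCell-trans (U i) (U j) (R₁ i j) (R₂ i j) (H i j)) (agree₁ i j & agree₂ i j)

    agree₂₁ : ∀ i j → (U i ∧ U j ⇒ᵇ (R₂ i j ⇔ᵇ R₁ i j)) ≡ true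
    agree₂₁ i j = ⇒ᵇ-elim (agreeCell-trans (U i) (U j) (R₂ i j) (R₁ i j) (H i j)) (agree₂ i j & agree₁ i j)

    union-orients : isOrientationOn G A∪B (R₁ ∪ᵣ R₂) ≡ true
    union-orients = orients-intro G A∪B (R₁ ∪ᵣ R₂) λ i j →
      ⇒ᵇ-elim (orientCell-∪ (A i) (A j) (B i) (B j) (U i) (U j) (adj G i j) (R₁ i j) (R₁ j i) (R₂ i j) (R₂ j i))
        (orient₁ i j & extends-orients′ A R₁ ext₁ i j & orient₂ i j & extends-orients′ B R₂ ext₂ i j
         & agree₁₂ i j & agree₁₂ j i & U⊆A i & U⊆A j & U⊆B i & U⊆B j & A∩B⊆U i & A∩B⊆U j & no-edge i j & no-edge′ i j)

    union-agrees : agreeOn U (R₁ ∪ᵣ R₂) H ≡ true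
    union-agrees = agrees-intro U (R₁ ∪ᵣ R₂) H λ i j →
      ⇒ᵇ-elim (agreeCell-∪ (U i) (U j) (R₁ i j) (R₂ i j) (H i j)) (agree₁ i j & agree₂ i j)

    union-restrict : ∀ i j → R₁ i j ≡ restrict A (R₁ ∪ᵣ R₂) i j × R₂ i j ≡ restrict B (R₁ ∪ᵣ R₂) i j
    union-restrict i j = ⇔ᵇ⇒≡ (∧-elimˡ both) , ⇔ᵇ⇒≡ (∧-elimʳ {R₁ i j ⇔ᵇ (A i ∧ A j ∧ (R₁ i j ∨ R₂ i j))} both)
      where
      both = ⇒ᵇ-elim (orientCell-∪-restrict (A i) (A j) (B i) (B j) (U i) (U j) (adj G i j) (R₁ i j) (R₁ j i) (R₂ i j) (R₂ j i))
                     (orient₁ i j & orient₂ i j & agree₁₂ i j & A∩B⊆U i & A∩B⊆U j)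

    union-edge : ∀ x y → (R₁ ∪ᵣ R₂) x y ≡ true → adj G x y ≡ true
    union-edge x y r = [ edge (A x) (A y) (R₁ x y) (R₁ y x) (orient₁ x y)
                       , edge (B x) (B y) (R₂ x y) (R₂ y x) (orient₂ x y) ]′ (∨-elim r)
      where
      edge : ∀ w w′ r r′ → orientCell w w′ (adj G x y) r r′ ≡ true → r ≡ true → adj G x y ≡ true
      edge w w′ r r′ o a = ∧-elimʳ {w′} (∧-elimʳ {w} (⇒ᵇ-elim (orientCell-arc w w′ (adj G x y) r r′) (o & a)))

    outside : VSet n → Fin n → Bool
    outside X x = X x ∧ not (U x)

    exclusive₁ : ∀ x y → R₁ x y ≡ true → R₂ x y ≡ false → (outside A x ∨ outside A y) ≡ true
    exclusive₁ x y r₁ ¬r₂ =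
      ⇒ᵇ-elim (orientCell-exclusive-arc (A x) (A y) (U x) (U y) (adj G x y) (R₁ x y) (R₁ y x) (R₂ x y))
              (orient₁ x y & r₁ & cong not ¬r₂ & agree₁₂ x y)

    exclusive₂ : ∀ x y → R₂ x y ≡ true → R₁ x y ≡ false → (outside B x ∨ outside B y) ≡ true
    exclusive₂ x y r₂ ¬r₁ =
      ⇒ᵇ-elim (orientCell-exclusive-arc (B x) (B y) (U x) (U y) (adj G x y) (R₂ x y) (R₂ y x) (R₁ x y))
              (orient₂ x y & r₂ & cong not ¬r₁ & agree₂₁ x y)

    unmixed : ∀ {k} (T : Rel₂ k) → F k T ≡ true → (φ : Fin k → Fin n)
            → (∀ i j → T i j ≡ true → (R₁ ∪ᵣ R₂) (φ i) (φ j) ≡ true)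
            → ∀ i j i′ j′ → R₁ (φ i) (φ j) ≡ true → R₂ (φ i) (φ j) ≡ false
            → R₂ (φ i′) (φ j′) ≡ true → R₁ (φ i′) (φ j′) ≡ false → ⊥
    unmixed {k} T T∈F φ arcs i j i′ j′ r₁ ¬r₂ r₂ ¬r₁ =
      cross (endpoint A i j (exclusive₁ _ _ r₁ ¬r₂)) (endpoint B i′ j′ (exclusive₂ _ _ r₂ ¬r₁))
      where
      endpoint : ∀ X a b → (outside X (φ a) ∨ outside X (φ b)) ≡ true → ∃ λ c → outside X (φ c) ≡ true
      endpoint X a b h = [ (a ,_) , (b ,_) ]′ (∨-elim {outside X (φ a)} h)
      cross : (∃ λ p → outside A (φ p) ≡ true) → (∃ λ q → outside B (φ q) ≡ true) → ⊥
      cross (p , ap) (q , bq) = true≢false (trans (sym edge) (not-elim nonadjacent))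
        where
        Ap = proj₁ (∧-not-elim {A (φ p)} {U (φ p)} ap)
        ¬Up = proj₂ (∧-not-elim {A (φ p)} {U (φ p)} ap)
        Bq = proj₁ (∧-not-elim {B (φ q)} {U (φ q)} bq)
        ¬Uq = proj₂ (∧-not-elim {B (φ q)} {U (φ q)} bq)
        nonadjacent : not (adj G (φ p) (φ q)) ≡ true
        nonadjacent = ⇒ᵇ-elim (no-edge (φ p) (φ q)) (Ap & Bq & cong not ¬Up & cong not ¬Uq)
        p≢q : ¬ p ≡ q
        p≢q refl = true≢false (trans (sym (⇒ᵇ-elim (A∩B⊆U (φ p)) (Ap & Bq))) ¬Up)
        edge : adj G (φ p) (φ q) ≡ true
        edge = [ (λ t → union-edge _ _ (arcs p q t)) , (λ t → trans (Graph.sym G (φ p) (φ q)) (union-edge _ _ (arcs q p t))) ]′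
                 (xor-elim (proj₂ (tournaments k T T∈F) p q p≢q))

    union-extends : extends A∪B (R₁ ∪ᵣ R₂) ≡ true
    union-extends = union-orients & union-agrees & free-∪ F R₁ R₂ (extends-free A R₁ ext₁) (extends-free B R₂ ext₂) unmixed

  restrict-extends : ∀ X → (∀ i → (U i ⇒ᵇ X i) ≡ true) → (∀ i → (X i ⇒ᵇ A∪B i) ≡ true)
                   → ∀ R → extends A∪B R ≡ true → extends X (restrict X R) ≡ true
  restrict-extends X U⊆X X⊆A∪B R ext =
      restrict-orients G X A∪B R X⊆A∪B (∧-elimˡ ext)
    & agrees-intro U (restrict X R) H (λ i j →
        ⇒ᵇ-elim (agreeCell-restrict (U i) (U j) (X i) (X j) (R i j) (H i j)) (U⊆X i & U⊆X j & extends-agrees A∪B R ext i j))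
    & free-antimono F R (restrict X R) (restrict-⊆ X R) (extends-free A∪B R ext)

  A⊆A∪B : ∀ i → (A i ⇒ᵇ A∪B i) ≡ true
  A⊆A∪B i = ⇒ᵇ-intro {A i} (λ a → cong (_∨ B i) a)

  B⊆A∪B : ∀ i → (B i ⇒ᵇ A∪B i) ≡ true
  B⊆A∪B i = ⇒ᵇ-intro {B i} (λ b → trans (cong (A i ∨_) b) (∨-zeroʳ (A i)))

  restrict-split : ∀ R → extends A∪B R ≡ true → ∀ i j → R i j ≡ (restrict A R ∪ᵣ restrict B R) i j
  restrict-split R ext i j = ⇔ᵇ⇒≡ (⇒ᵇ-elim (orientCell-split (A i) (A j) (B i) (B j) (U i) (U j) (adj G i j) (R i j) (R j i))
    (extends-orients A∪B R ext i j & U⊆A i & U⊆A j & U⊆B i & U⊆B j & no-edge i j & no-edge′ i j))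

  pairs : List (Rel₂ n × Rel₂ n)
  pairs = cartesianProduct (allRel n) (allRel n)

  sameRelPairᵇ : Rel₂ n × Rel₂ n → Rel₂ n × Rel₂ n → Bool
  sameRelPairᵇ R₁₂ S₁₂ = sameRelᵇ (proj₁ R₁₂) (proj₁ S₁₂) ∧ sameRelᵇ (proj₂ R₁₂) (proj₂ S₁₂)

  count-sameRelPair : ∀ S₁₂ → countᵇ (λ R₁₂ → sameRelPairᵇ R₁₂ S₁₂) pairs ≡ 1
  count-sameRelPair (S₁ , S₂) =
    trans (count-cartesianProduct (λ R₁ → sameRelᵇ R₁ S₁) (λ R₂ → sameRelᵇ R₂ S₂) (allRel n) (allRel n))
          (cong₂ _*_ (count-sameRel S₁) (count-sameRel S₂))

  restrictions⇔union : ∀ R R₁₂ → (extends A∪B R ∧ sameRelPairᵇ R₁₂ (restrict A R , restrict B R))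
                    ≡ ((extends A (proj₁ R₁₂) ∧ extends B (proj₂ R₁₂)) ∧ sameRelᵇ R (proj₁ R₁₂ ∪ᵣ proj₂ R₁₂))
  restrictions⇔union R (R₁ , R₂) = true-ext to from
    where
    to : (extends A∪B R ∧ sameRelPairᵇ (R₁ , R₂) (restrict A R , restrict B R)) ≡ true
       → ((extends A R₁ ∧ extends B R₂) ∧ sameRelᵇ R (R₁ ∪ᵣ R₂)) ≡ true
    to h = (trans (extends-congʳ F G U H A R₁ (restrict A R) e₁) (restrict-extends A U⊆A A⊆A∪B R ext)
           & trans (extends-congʳ F G U H B R₂ (restrict B R) e₂) (restrict-extends B U⊆B B⊆A∪B R ext))
         & sameRelᵇ-intro R (R₁ ∪ᵣ R₂) (λ i j → trans (restrict-split R ext i j) (sym (cong₂ _∨_ (e₁ i j) (e₂ i j))))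
      where
      ext = ∧-elimˡ h
      same = ∧-elimʳ {extends A∪B R} h
      e₁ = sameRelᵇ-elim R₁ (restrict A R) (∧-elimˡ same)
      e₂ = sameRelᵇ-elim R₂ (restrict B R) (∧-elimʳ {sameRelᵇ R₁ (restrict A R)} same)
    from : ((extends A R₁ ∧ extends B R₂) ∧ sameRelᵇ R (R₁ ∪ᵣ R₂)) ≡ true
         → (extends A∪B R ∧ sameRelPairᵇ (R₁ , R₂) (restrict A R , restrict B R)) ≡ true
    from h = trans (extends-congʳ F G U H A∪B R (R₁ ∪ᵣ R₂) e) union-extends
           & sameRelᵇ-intro R₁ (restrict A R) (λ i j → trans (proj₁ (union-restrict i j)) (restrict-≗ A i j))
           & sameRelᵇ-intro R₂ (restrict B R) (λ i j → trans (proj₂ (union-restrict i j)) (restrict-≗ B i j))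
      where
      ext₁ = ∧-elimˡ (∧-elimˡ h)
      ext₂ = ∧-elimʳ {extends A R₁} (∧-elimˡ h)
      e = sameRelᵇ-elim R (R₁ ∪ᵣ R₂) (∧-elimʳ {extends A R₁ ∧ extends B R₂} h)
      open Union R₁ R₂ ext₁ ext₂
      restrict-≗ : ∀ X i j → restrict X (R₁ ∪ᵣ R₂) i j ≡ restrict X R i j
      restrict-≗ X i j = cong (λ z → X i ∧ X j ∧ z) (sym (e i j))

  #extensions-∪ : ∀ W → (∀ i → W i ≡ A i ∨ B i)
                → #extensions F G U H W ≡ #extensions F G U H A * #extensions F G U H B
  #extensions-∪ W W≡A∪B = begin
    countᵇ (extends W) (allRel n)
      ≡⟨ #extensions-congᵂ F G U H W A∪B W≡A∪B ⟩
    countᵇ (extends A∪B) (allRel n)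
      ≡⟨ count-bijection (extends A∪B) (λ R₁₂ → extends A (proj₁ R₁₂) ∧ extends B (proj₂ R₁₂)) (allRel n) pairs
                         sameRelᵇ sameRelPairᵇ count-sameRel count-sameRelPair
                         (λ R → restrict A R , restrict B R) (λ R₁₂ → proj₁ R₁₂ ∪ᵣ proj₂ R₁₂) restrictions⇔union ⟩
    countᵇ (λ R₁₂ → extends A (proj₁ R₁₂) ∧ extends B (proj₂ R₁₂)) pairs
      ≡⟨ count-cartesianProduct (extends A) (extends B) (allRel n) (allRel n) ⟩
    countᵇ (extends A) (allRel n) * countᵇ (extends B) (allRel n) ∎
    where open ≡-Reasoning

-- For an independent set S with complement U, the F-free orientations of G restricting to H on U
-- are counted by choosing the arcs at each vertex of S independently.

module Decomposition {n : ℕ} (F : Family) (tournaments : ∀ k (T : Rel₂ k) → F k T ≡ true → IsTournament T)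
                     (G : Graph n) (S : VSet n) (independent : Independent G S) where

  U : VSet n
  U = compl S

  _∈ᵇ_ : Fin n → List (Fin n) → Bool
  i ∈ᵇ xs = any (i ≟ᵇ_) xs

  U+ : List (Fin n) → VSet n
  U+ xs i = U i ∨ (i ∈ᵇ xs)

  ∈⇒∈ᵇ : ∀ {i xs} → i ∈ xs → (i ∈ᵇ xs) ≡ true
  ∈⇒∈ᵇ {i} i∈xs = any-intro (i ≟ᵇ_) i∈xs (≟ᵇ-refl i)

  ∉⇒∈ᵇ-false : ∀ {i} xs → All (λ y → ¬ i ≡ y) xs → (i ∈ᵇ xs) ≡ false
  ∉⇒∈ᵇ-false [] [] = refl
  ∉⇒∈ᵇ-false (y ∷ ys) (i≢y ∷ i∉ys) rewrite ≢⇒≟ᵇ-false i≢y = ∉⇒∈ᵇ-false ys i∉ys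

  module _ (H : Rel₂ n) (H-orients : isOrientationOn G U H ≡ true) (H-free : freeᵇ F H ≡ true) where

    #extensions-U : #extensions F G U H U ≡ 1
    #extensions-U = trans (count-cong (allRel n) extends⇔same) (count-sameRel H)
      where
      extends⇔same : ∀ R → extendsᵇ F G U H U R ≡ sameRelᵇ R H
      extends⇔same R = true-ext to from
        where
        to : extendsᵇ F G U H U R ≡ true → sameRelᵇ R H ≡ true
        to h = sameRelᵇ-intro R H λ i j → ⇔ᵇ⇒≡ (⇒ᵇ-elim
          (agreeCell-unique (U i) (U j) (adj G i j) (R i j) (R j i) (H i j) (H j i))
          (orients-elim G U R (∧-elimˡ h) i j & orients-elim G U H H-orients i j
           & agrees-elim U R H (∧-elimˡ (∧-elimʳ {isOrientationOn G U R} h)) i j))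
        from : sameRelᵇ R H ≡ true → extendsᵇ F G U H U R ≡ true
        from h = trans (orients-congʳ G U R H R≗H) H-orients
               & trans (agrees-congˡ U R H H R≗H) (agrees-intro U H H (λ i j → agreeCell-refl (U i) (U j) (H i j)))
               & trans (free-cong F R H R≗H) H-free
          where
          R≗H = sameRelᵇ-elim R H h

    #extensions-U+ : ∀ xs → Unique xs → #extensions F G U H (U+ xs) ≡ product (map (λ x → cF F G U x H) xs)
    #extensions-U+ [] [] =
      trans (#extensions-congᵂ F G U H (U+ []) U (λ i → ∨-identityʳ (U i))) #extensions-U
    #extensions-U+ (x ∷ xs) (x∉xs ∷ xs-unique) = begin
      #extensions F G U H (U+ (x ∷ xs))
        ≡⟨ Gluing.#extensions-∪ F tournaments G U H (U+ xs) (addV U x) (λ i → ⇒ᵇ-intro {U i} (cong (_∨ _)))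
             (λ i → ⇒ᵇ-intro {U i} (cong (_∨ _))) A∩B⊆U no-edge (U+ (x ∷ xs)) U+-∷ ⟩
      #extensions F G U H (U+ xs) * cF F G U x H
        ≡⟨ cong (_* cF F G U x H) (#extensions-U+ xs xs-unique) ⟩
      product (map (λ x → cF F G U x H) xs) * cF F G U x H
        ≡⟨ *-comm _ (cF F G U x H) ⟩
      product (map (λ x → cF F G U x H) (x ∷ xs)) ∎
      where
      open ≡-Reasoning
      A∩B⊆U : ∀ i → ((U i ∨ (i ∈ᵇ xs)) ∧ (U i ∨ (i ≟ᵇ x)) ⇒ᵇ U i) ≡ true
      A∩B⊆U i = ⇒ᵇ-elim (disjoint-union (U i) (i ∈ᵇ xs) (i ≟ᵇ x)) (⇒ᵇ-intro {i ≟ᵇ x} λ i≡x →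
        cong not (subst (λ z → (z ∈ᵇ xs) ≡ false) (sym (≟ᵇ⇒≡ i≡x)) (∉⇒∈ᵇ-false xs x∉xs)))
        where
        disjoint-union : ∀ u m q → ((q ⇒ᵇ not m) ⇒ᵇ ((u ∨ m) ∧ (u ∨ q) ⇒ᵇ u)) ≡ true
        disjoint-union = valid-sound 3 _ refl
      U+-∷ : ∀ i → U+ (x ∷ xs) i ≡ (U i ∨ (i ∈ᵇ xs)) ∨ (U i ∨ (i ≟ᵇ x))
      U+-∷ i = ⇔ᵇ⇒≡ (regroup (U i) (i ≟ᵇ x) (i ∈ᵇ xs))
        where
        regroup : ∀ u q m → ((u ∨ (q ∨ m)) ⇔ᵇ ((u ∨ m) ∨ (u ∨ q))) ≡ true
        regroup = valid-sound 3 _ refl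
      no-edge : ∀ i j → ((U i ∨ (i ∈ᵇ xs)) ∧ (U j ∨ (j ≟ᵇ x)) ∧ not (U i) ∧ not (U j) ⇒ᵇ not (adj G i j)) ≡ true
      no-edge i j = ⇒ᵇ-intro λ h →
        let outside = ∧-elimʳ {U j ∨ (j ≟ᵇ x)} (∧-elimʳ {U i ∨ (i ∈ᵇ xs)} h)
        in cong not (independent i j (not-not (∧-elimˡ outside)) (not-not (∧-elimʳ {not (U i)} outside)))
        where
        not-not : ∀ {a} → not (not a) ≡ true → a ≡ true
        not-not {true} _ = refl

  S-list : List (Fin n)
  S-list = filterᵇ S (allFin n)

  Dnum-decomposition : Dnum F G ≡ ∑[ H ∈ DList F G U ] product (map (λ x → cF F G U x H) S-list)
  Dnum-decomposition = trans (Dnum-by-restriction F G U) (∑-cong (DList F G U) per-H)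
    where
    everything≗U+S : ∀ i → everything i ≡ U+ S-list i
    everything≗U+S i with S i in i∈S
    ... | false = refl
    ... | true = sym (∈⇒∈ᵇ (filterᵇ⁺ S (∈-allFin i) i∈S))
    per-H : ∀ {H} → H ∈ DList F G U → #extensions F G U H everything ≡ product (map (λ x → cF F G U x H) S-list)
    per-H {H} H∈ = trans (#extensions-congᵂ F G U H everything (U+ S-list) everything≗U+S)
                         (#extensions-U+ H (∧-elimˡ H-ok) (∧-elimʳ {isOrientationOn G U H} H-ok) S-list
                                         (filter⁺ (T? ∘ S) (allFin⁺ n)))
      where
      H-ok = proj₂ (filterᵇ⁻ (λ R → isOrientationOn G U R ∧ freeᵇ F R) {allRel n} H∈)

-- In the twin graph, every vertex of S is joined to the neighbours of v; swapping a vertex x ∈ S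
-- with v turns extensions at x in the twin graph into extensions at v in G.

module Twins {n : ℕ} (F : Family) (G : Graph n) (S : VSet n) (v : Fin n) (v∈S : S v ≡ true) where

  U : VSet n
  U = compl S

  G̃ : Graph n
  G̃ = twinGraph G S v

  U⇒S-false : ∀ {i} → U i ≡ true → S i ≡ false
  U⇒S-false {i} Ui with S i
  ... | false = refl

  retarget-U : ∀ i → U i ≡ true → retarget S v i ≡ i
  retarget-U i Ui rewrite U⇒S-false Ui = refl

  twin-independent : Independent G̃ S
  twin-independent i j i∈S j∈S rewrite i∈S | j∈S = irrefl G v

  twin-orients-U : ∀ R → isOrientationOn G̃ U R ≡ isOrientationOn G U R
  twin-orients-U R = allᶠ²-cong λ i j → orientCell-congᵉ (U i) (U j) (R i j) (R j i)
    λ Ui Uj → cong₂ (adj G) (retarget-U i Ui) (retarget-U j Uj)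

  twin-DList : DList F G̃ U ≡ DList F G U
  twin-DList = filterᵇ-cong (allRel n) (λ R → cong (_∧ freeᵇ F R) (twin-orients-U R))

  module _ (x : Fin n) (x∈S : S x ≡ true) where

    σ : Fin n → Fin n
    σ = transpose x v

    σ-involutive : ∀ i → σ (σ i) ≡ i
    σ-involutive = transpose-involutive x v

    U≢S : ∀ {i a} → U i ≡ true → S a ≡ true → ¬ i ≡ a
    U≢S Ui Sa refl = true≢false (trans (sym Sa) (U⇒S-false Ui))

    σ-U : ∀ i → U i ≡ true → σ i ≡ i
    σ-U i Ui = transpose-other x v (U≢S Ui x∈S) (U≢S Ui v∈S)

    addV-σ : ∀ i → addV U v (σ i) ≡ addV U x i
    addV-σ i = by-cases (i ≟F x) (i ≟F v)
      where
      by-cases : Dec (i ≡ x) → Dec (i ≡ v) → addV U v (σ i) ≡ addV U x i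
      by-cases (yes refl) _ rewrite transpose-x x v | ≟ᵇ-refl v | ≟ᵇ-refl i = trans (∨-zeroʳ (U v)) (sym (∨-zeroʳ (U i)))
      by-cases (no i≢x) (yes refl)
        rewrite transpose-v x v | ≢⇒≟ᵇ-false i≢x | ≢⇒≟ᵇ-false (λ e → i≢x (sym e)) | x∈S | v∈S = refl
      by-cases (no i≢x) (no i≢v) rewrite transpose-other x v i≢x i≢v | ≢⇒≟ᵇ-false i≢x | ≢⇒≟ᵇ-false i≢v = refl

    retarget-σ : ∀ i → addV U x i ≡ true → retarget S v i ≡ σ i
    retarget-σ i i∈ with S i in i∈S
    ... | false = sym (σ-U i (cong not i∈S))
    ... | true = trans (sym (transpose-x x v)) (cong σ (sym (≟ᵇ⇒≡ {i = i} {x} i∈)))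

    _∘σ : Rel₂ n → Rel₂ n
    (R ∘σ) i j = R (σ i) (σ j)

    cell-relabel : ∀ R i j
      → orientCell (addV U v (σ i)) (addV U v (σ j)) (adj G (σ i) (σ j)) (R (σ (σ i)) (σ (σ j))) (R (σ (σ j)) (σ (σ i)))
      ≡ orientCell (addV U x i) (addV U x j) (adj G̃ i j) (R i j) (R j i)
    cell-relabel R i j = begin
      orientCell (addV U v (σ i)) (addV U v (σ j)) (adj G (σ i) (σ j)) (R (σ (σ i)) (σ (σ j))) (R (σ (σ j)) (σ (σ i)))
        ≡⟨ cong₂ (λ a b → orientCell a b (adj G (σ i) (σ j)) (R (σ (σ i)) (σ (σ j))) (R (σ (σ j)) (σ (σ i))))
                 (addV-σ i) (addV-σ j) ⟩
      orientCell (addV U x i) (addV U x j) (adj G (σ i) (σ j)) (R (σ (σ i)) (σ (σ j))) (R (σ (σ j)) (σ (σ i)))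
        ≡⟨ cong₂ (orientCell (addV U x i) (addV U x j) (adj G (σ i) (σ j)))
                 (cong₂ R (σ-involutive i) (σ-involutive j)) (cong₂ R (σ-involutive j) (σ-involutive i)) ⟩
      orientCell (addV U x i) (addV U x j) (adj G (σ i) (σ j)) (R i j) (R j i)
        ≡⟨ orientCell-congᵉ (addV U x i) (addV U x j) (R i j) (R j i)
             (λ i∈ j∈ → sym (cong₂ (adj G) (retarget-σ i i∈) (retarget-σ j j∈))) ⟩
      orientCell (addV U x i) (addV U x j) (adj G̃ i j) (R i j) (R j i) ∎
      where open ≡-Reasoning

    orients-relabel : ∀ R → isOrientationOn G (addV U v) (R ∘σ) ≡ isOrientationOn G̃ (addV U x) R
    orients-relabel R = trans (allᶠ²-relabel σ σ-involutive _) (allᶠ²-cong (cell-relabel R))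

    agrees-relabel : ∀ R H → agreeOn U (R ∘σ) H ≡ agreeOn U R H
    agrees-relabel R H = allᶠ²-cong λ i j → agreeCell-congʳ (U i) (U j) (H i j) λ Ui Uj → cong₂ R (σ-U i Ui) (σ-U j Uj)

    twin-cF : ∀ H → cF F G̃ U x H ≡ cF F G U v H
    twin-cF H = count-bijection ext̃ ext (allRel n) (allRel n) sameRelᵇ sameRelᵇ count-sameRel count-sameRel _∘σ _∘σ graph
      where
      ext̃ ext : Rel₂ n → Bool
      ext̃ = extendsᵇ F G̃ U H (addV U x)
      ext = extendsᵇ F G U H (addV U v)
      ext-relabel : ∀ R → ext (R ∘σ) ≡ ext̃ R
      ext-relabel R = cong₂ _∧_ (orients-relabel R) (cong₂ _∧_ (agrees-relabel R H) (free-relabel F σ σ-involutive R))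
      relabel-back : ∀ R R′ → (∀ i j → R′ i j ≡ (R ∘σ) i j) → ∀ i j → R i j ≡ (R′ ∘σ) i j
      relabel-back R R′ e i j = sym (trans (e (σ i) (σ j)) (cong₂ R (σ-involutive i) (σ-involutive j)))
      graph : ∀ R R′ → (ext̃ R ∧ sameRelᵇ R′ (R ∘σ)) ≡ (ext R′ ∧ sameRelᵇ R (R′ ∘σ))
      graph R R′ = true-ext to from
        where
        to : (ext̃ R ∧ sameRelᵇ R′ (R ∘σ)) ≡ true → (ext R′ ∧ sameRelᵇ R (R′ ∘σ)) ≡ true
        to h = trans (extends-congʳ F G U H (addV U v) R′ (R ∘σ) e) (trans (ext-relabel R) (∧-elimˡ h))
             & sameRelᵇ-intro R (R′ ∘σ) (relabel-back R R′ e)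
          where e = sameRelᵇ-elim R′ (R ∘σ) (∧-elimʳ {ext̃ R} h)
        from : (ext R′ ∧ sameRelᵇ R (R′ ∘σ)) ≡ true → (ext̃ R ∧ sameRelᵇ R′ (R ∘σ)) ≡ true
        from h = trans (sym (ext-relabel R)) (trans (extends-congʳ F G U H (addV U v) (R ∘σ) R′ R∘σ≗R′) (∧-elimˡ h))
               & sameRelᵇ-intro R′ (R ∘σ) (relabel-back R′ R e)
          where
          e = sameRelᵇ-elim R (R′ ∘σ) (∧-elimʳ {ext R′} h)
          R∘σ≗R′ = λ i j → sym (relabel-back R′ R e i j)

module Symmetrisation {n : ℕ} (F : Family) (tournaments : ∀ k (T : Rel₂ k) → F k T ≡ true → IsTournament T)
                      (G : Graph n) (S : VSet n) (independent : Independent G S) where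

  open Decomposition F tournaments G S independent using (U; S-list; Dnum-decomposition)

  s : ℕ
  s = size S

  c : Fin n → Rel₂ n → ℕ
  c x H = cF F G U x H

  ∈S-list : ∀ {u} → S u ≡ true → u ∈ S-list
  ∈S-list u∈S = filterᵇ⁺ S (∈-allFin _) u∈S

  S-list⊆S : ∀ {u} → u ∈ S-list → S u ≡ true
  S-list⊆S u∈ = proj₂ (filterᵇ⁻ S {allFin n} u∈)

  s·Dnum≡ : s * Dnum F G ≡ ∑[ H ∈ DList F G U ] (s * product (map (λ x → c x H) S-list))
  s·Dnum≡ = trans (cong (s *_) Dnum-decomposition) (sym (∑-*ˡ s _ (DList F G U)))

  amgm-at : ∀ H → s * product (map (λ x → c x H) S-list) ≤ ∑[ x ∈ S-list ] c x H ^ s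
  amgm-at H = amgm (λ x → c x H) S-list

  ∑∑≡∑normPow : ∑[ H ∈ DList F G U ] ∑[ x ∈ S-list ] c x H ^ s ≡ ∑[ x ∈ S-list ] normPow F G U x s
  ∑∑≡∑normPow = ∑-comm (λ H x → c x H ^ s) (DList F G U) S-list

  s·Dnum≤∑normPow : s * Dnum F G ≤ ∑[ x ∈ S-list ] normPow F G U x s
  s·Dnum≤∑normPow = begin
    s * Dnum F G                                        ≡⟨ s·Dnum≡ ⟩
    ∑[ H ∈ DList F G U ] (s * product (map (λ x → c x H) S-list))
                                                        ≤⟨ ∑-mono-≤ (DList F G U) (λ {H} _ → amgm-at H) ⟩
    ∑[ H ∈ DList F G U ] ∑[ x ∈ S-list ] c x H ^ s      ≡⟨ ∑∑≡∑normPow ⟩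
    ∑[ x ∈ S-list ] normPow F G U x s                   ∎
    where open ≤-Reasoning

  Dnum-twin : ∀ v → S v ≡ true → Dnum F (twinGraph G S v) ≡ normPow F G U v s
  Dnum-twin v v∈S = begin
    Dnum F G̃
      ≡⟨ Decomposition.Dnum-decomposition F tournaments G̃ S twin-independent ⟩
    ∑[ H ∈ DList F G̃ U ] product (map (λ x → cF F G̃ U x H) S-list)
      ≡⟨ cong (λ Hs → ∑[ H ∈ Hs ] product (map (λ x → cF F G̃ U x H) S-list)) twin-DList ⟩
    ∑[ H ∈ DList F G U ] product (map (λ x → cF F G̃ U x H) S-list)
      ≡⟨ ∑-cong (DList F G U) (λ {H} _ → trans (product-cong S-list (λ {x} x∈ → twin-cF x (S-list⊆S x∈) H))
                                                (product-const (c v H) S-list)) ⟩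
    normPow F G U v s ∎
    where
    open ≡-Reasoning
    open Twins F G S v v∈S using (G̃; twin-independent; twin-DList; twin-cF)

  cancel-s : ∀ {v a b} → S v ≡ true → s * a ≤ s * b → a ≤ b
  cancel-s v∈S = cancel-length (∈S-list v∈S)
    where
    cancel-length : ∀ {xs : List (Fin n)} {v a b} → v ∈ xs → length xs * a ≤ length xs * b → a ≤ b
    cancel-length {_ ∷ xs} _ = *-cancelˡ-≤ (suc (length xs))

  Maximises : Fin n → Set
  Maximises v = ∀ u → S u ≡ true → normPow F G U u s ≤ normPow F G U v s

  ∑normPow≤s·Dnum-twin : ∀ v → S v ≡ true → Maximises v → ∑[ x ∈ S-list ] normPow F G U x s ≤ s * Dnum F (twinGraph G S v)
  ∑normPow≤s·Dnum-twin v v∈S v-max = begin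
    ∑[ x ∈ S-list ] normPow F G U x s    ≤⟨ ∑-mono-≤ S-list (λ {x} x∈ → v-max x (S-list⊆S x∈)) ⟩
    ∑[ x ∈ S-list ] normPow F G U v s    ≡⟨ ∑-const _ S-list ⟩
    s * normPow F G U v s                ≡⟨ cong (s *_) (sym (Dnum-twin v v∈S)) ⟩
    s * Dnum F (twinGraph G S v)         ∎
    where open ≤-Reasoning

  twin-improves : ∀ v → S v ≡ true → Maximises v → Dnum F G ≤ Dnum F (twinGraph G S v)
  twin-improves v v∈S v-max = cancel-s v∈S (≤-trans s·Dnum≤∑normPow (∑normPow≤s·Dnum-twin v v∈S v-max))

  maximiser : ∃ (λ v → S v ≡ true) → ∃ λ v → S v ≡ true × Maximises v
  maximiser (v₀ , v₀∈S) =
    argmax f v₀ S-list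
    , argmax-all f {P = λ x → S x ≡ true} v₀∈S (All.tabulate S-list⊆S)
    , λ u u∈S → v≤f[argmax]⁺ v₀ S-list (inj₂ (Any.map (λ { refl → ≤-refl }) (∈S-list u∈S)))
    where
    f : Fin n → ℕ
    f x = normPow F G U x s

  -- For extremal G the twin graph cannot do better, so every AM-GM inequality used above is tight.
  extremal-amgm-tight : ∃ (λ v → S v ≡ true) → Extremal F G → ∀ {H} → H ∈ DList F G U
                      → s * product (map (λ x → c x H) S-list) ≡ ∑[ x ∈ S-list ] c x H ^ s
  extremal-amgm-tight S≢∅ extremal = ∑-tight (DList F G U) (λ {H} _ → amgm-at H) (begin
    ∑[ H ∈ DList F G U ] ∑[ x ∈ S-list ] c x H ^ s    ≡⟨ ∑∑≡∑normPow ⟩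
    ∑[ x ∈ S-list ] normPow F G U x s                 ≤⟨ ∑normPow≤s·Dnum-twin v v∈S v-max ⟩
    s * Dnum F (twinGraph G S v)                      ≤⟨ *-monoʳ-≤ s (extremal (twinGraph G S v)) ⟩
    s * Dnum F G                                      ≡⟨ s·Dnum≡ ⟩
    ∑[ H ∈ DList F G U ] (s * product (map (λ x → c x H) S-list)) ∎)
    where
    open ≤-Reasoning
    v = proj₁ (maximiser S≢∅)
    v∈S = proj₁ (proj₂ (maximiser S≢∅))
    v-max = proj₂ (proj₂ (maximiser S≢∅))

  extremal-equal : ∃ (λ v → S v ≡ true) → Extremal F G → ∀ u w → S u ≡ true → S w ≡ true
                 → ∀ H → (isOrientationOn G U H ∧ freeᵇ F H) ≡ true → c u H ≡ c w H
  extremal-equal S≢∅ extremal u w u∈S w∈S H H-ok = begin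
    c u H   ≡⟨ #extensions-congᴴ F G U H H′ (addV U u) (λ i j → sym (H′≗H i j)) ⟩
    c u H′  ≡⟨ amgm-equality (λ x → c x H′) S-list (extremal-amgm-tight S≢∅ extremal H′∈)
                             (∈S-list u∈S) (∈S-list w∈S) ⟩
    c w H′  ≡⟨ #extensions-congᴴ F G U H′ H (addV U w) H′≗H ⟩
    c w H   ∎
    where
    open ≡-Reasoning
    H′ = proj₁ (allRel-complete H)
    H′≗H = proj₂ (proj₂ (allRel-complete H))
    H′∈ : H′ ∈ DList F G U
    H′∈ = filterᵇ⁺ (λ R → isOrientationOn G U R ∧ freeᵇ F R) (proj₁ (proj₂ (allRel-complete H)))
            (trans (cong₂ _∧_ (orients-congʳ G U H′ H H′≗H) (free-cong F H′ H H′≗H)) H-ok)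

lemma2p3 : ∀ {n : ℕ} (F : Family)
    → (∀ k (T : Rel₂ k) → F k T ≡ true → IsTournament T)
    → (∀ k (T : Rel₂ k) → F k T ≡ true → 3 ≤ k)
    → (G : Graph n) (S : VSet n)
    → ∃ (λ v → S v ≡ true)
    → Independent G S
    → ((v : Fin n) → S v ≡ true
         → (∀ u → S u ≡ true → normPow F G (compl S) u (size S) ≤ normPow F G (compl S) v (size S))
         → Dnum F G ≤ Dnum F (twinGraph G S v))
      × (Extremal F G
         → ∀ u w → S u ≡ true → S w ≡ true
         → ∀ (Ho : Rel₂ n) → (isOrientationOn G (compl S) Ho ∧ freeᵇ F Ho) ≡ true
         → cF F G (compl S) u Ho ≡ cF F G (compl S) w Ho)
lemma2p3 F tournaments _ G S S≢∅ independent = twin-improves , extremal-equal S≢∅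
  where open Symmetrisation F tournaments G S independent
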